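{- Let $G$ be a finite simple graph which is bipartite, or complete multipartite, or a blowup of a cycle. Then $\nu(G)=\eta(G)$.
   Context: A digraph $D=(V,E)$ has a finite vertex set and arc set $E\subseteq V\times V$ with no loops. For an $n$-vertex digraph $D$, a permutation of $D$ is a bijection $\sigma:V\to[n]$; an arc $u\to v$ is a descent of $\sigma$ if $\sigma(u)>\sigma(v)$, and $\mathrm{des}_D(\sigma)$ is the number of descents. The Eulerian polynomial of $D$ is $A_D(t)=\sum_{\sigma}t^{\mathrm{des}_D(\sigma)}$, summed over all bijections $\sigma:V\to[n]$. For a graph $G$, $\nu(G):=|A_D(-1)|$ where $D$ is any orientation of $G$ (this value does not depend on the orientation chosen). An ordering $\pi=(\pi_1,\dots,\pi_n)$ of $V(G)$ is an even sequence if for every $1\le i\le n$ the induced subgraph $G[\{\pi_1,\dots,\pi_i\}]$ has an even number of edges; $\eta(G)$ is the number of even sequences of $G$. A graph is complete multipartite if its vertex set can be partitioned into sets $V_1,\dots,V_r$ with $u,v$ adjacent iff they lie in different parts. A graph is a blowup of a cycle if its vertex set can be partitioned into sets $V_1,\dots,V_r$ such that $u,v$ are adjacent iff $u\in V_i$ and $v\in V_{i+1}$ for some $i$ (indices modulo $r$). -}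

module Defs where

open import Data.Nat using (ℕ; zero; suc; _+_; _%_; _<ᵇ_)
open import Data.Nat.Divisibility using (_∣_)
open import Data.Bool using (Bool; true; false; _∧_; _∨_; not; if_then_else_)
open import Data.Fin using (Fin; toℕ; _≟_)
open import Data.Nat.ListAction using (sum)
open import Data.List using (List; []; _∷_; map; concatMap; filter; length; foldr; take; upTo; allFin; applyUpTo)
open import Data.Vec using (Vec; []; _∷_; lookup; toList)
open import Data.Integer using (ℤ; +_; -_) renaming (_+_ to _+ℤ_)
open import Data.Product using (Σ; ∃; _×_; _,_)
open import Data.Sum using (_⊎_)
open import Relation.Nullary using (¬_; does)
open import Relation.Binary.PropositionalEquality using (_≡_; _≢_)
open import Function.Bundles using (_⇔_)

record Graph (n : ℕ) : Set where
  field
    adj    : Fin n → Fin n → Bool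
    sym    : ∀ u v → adj u v ≡ adj v u
    irrefl : ∀ u → adj u u ≡ false
open Graph public

Digraph : ℕ → Set
Digraph n = Fin n → Fin n → Bool

IsOrientation : ∀ {n} → Graph n → Digraph n → Set
IsOrientation {n} G D =
  (∀ u v → D u v ≡ true → D v u ≡ false) ×
  (∀ u v → adj G u v ≡ (D u v ∨ D v u))

allVecs : ∀ {m} (n : ℕ) → List (Vec (Fin m) n)
allVecs zero    = [] ∷ []
allVecs {m} (suc n) = concatMap (λ x → map (x ∷_) (allVecs n)) (allFin m)

allDistinct : ∀ {m} → List (Fin m) → Bool
allDistinct [] = true
allDistinct (x ∷ xs) = not (foldr (λ y b → does (x ≟ y) ∨ b) false xs) ∧ allDistinct xs

-- all bijections Fin n → Fin n, each listed exactly once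
-- (an injective map Fin n → Fin n is a bijection)
bijections : (n : ℕ) → List (Vec (Fin n) n)
bijections n = filter (λ v → allDistinct (toList v) Data.Bool.≟ true) (allVecs n)

count : ∀ {A : Set} → (A → Bool) → List A → ℕ
count p xs = length (filter (λ x → p x Data.Bool.≟ true) xs)

des : ∀ {n} → Digraph n → Vec (Fin n) n → ℕ
des {n} D σ =
  sum (map (λ u → count (λ v → D u v ∧ (toℕ (lookup σ v) <ᵇ toℕ (lookup σ u))) (allFin n)) (allFin n))

signPow : ℕ → ℤ
signPow zero    = + 1
signPow (suc k) = - signPow k

sumℤ : List ℤ → ℤ
sumℤ = foldr _+ℤ_ (+ 0)

eulerianAtMinusOne : ∀ {n} → Digraph n → ℤ
eulerianAtMinusOne {n} D = sumℤ (map (λ σ → signPow (des D σ)) (bijections n))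

edgesIn : ∀ {n} → Graph n → List (Fin n) → ℕ
edgesIn G [] = 0
edgesIn G (x ∷ xs) = count (adj G x) xs + edgesIn G xs

isEvenᵇ : ℕ → Bool
isEvenᵇ k = does (k % 2 Data.Nat.≟ 0)

isEvenSequence : ∀ {n} → Graph n → Vec (Fin n) n → Bool
isEvenSequence {n} G π =
  foldr _∧_ true (applyUpTo (λ j → isEvenᵇ (edgesIn G (take (suc j) (toList π)))) n)

η : ∀ {n} → Graph n → ℕ
η {n} G = count (isEvenSequence G) (bijections n)

IsBipartite : ∀ {n} → Graph n → Set
IsBipartite {n} G = Σ (Fin n → Bool) λ c → ∀ u v → adj G u v ≡ true → c u ≢ c v

IsCompleteMultipartite : ∀ {n} → Graph n → Set
IsCompleteMultipartite {n} G =
  Σ ℕ λ r → Σ (Fin n → Fin r) λ part →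
    ∀ u v → (adj G u v ≡ true) ⇔ (part u ≢ part v)

-- blowup of a cycle C_r (r = suc k ≥ 1) with parts V_0,…,V_{r-1}:
-- distinct u,v adjacent iff part v = part u + 1 or part u = part v + 1 (mod r)
IsCycleBlowup : ∀ {n} → Graph n → Set
IsCycleBlowup {n} G =
  Σ ℕ λ k → Σ (Fin n → Fin (suc k)) λ part →
    ∀ u v → u ≢ v →
      (adj G u v ≡ true) ⇔
        ((toℕ (part v) ≡ suc (toℕ (part u)) % suc k) ⊎
         (toℕ (part u) ≡ suc (toℕ (part v)) % suc k))

{-# OPTIONS --safe #-}

-- Orderings of a vertex set S are grouped by their first vertex y.  Read backwards, an ordering
-- is an even sequence iff S spans an even number of edges and the rest is such an ordering of
-- S ∖ y; if S spans an odd number of edges, reversal flips the parity of the descent number,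
-- so the signed count over S vanishes.  Hence |A_D(-1)| = η(G) once all even sequences share
-- one descent parity, which follows from a potential β on vertex sets with
-- β(S) ≡ outdeg(y, S ∖ y) + β(S ∖ y) (mod 2) whenever S and S ∖ y span evenly many edges.
-- Reorienting changes β by the parity of reversed arcs inside S, so one orientation per class
-- suffices: for bipartite graphs orient away from one side (β = 0); for complete multipartite
-- graphs orient towards the later part (β = 0; sets meeting two parts oddly have no even
-- sequences); for blowups of C_r, r ≥ 3, orient each part towards the next, with β the parity
-- of half the number of consecutive pairs of parts both met an odd number of times.

module Submission where

open import Defs hiding (sym)

open import Algebra.Bundles using (CommutativeRing)
open import Data.Bool using (Bool; true; false; _∧_; _∨_; not; _xor_)
import Data.Bool.Properties as B
open import Data.Fin using (Fin; toℕ; _≟_; punchOut)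
import Data.Fin.Properties as Fin
open import Data.Integer using (ℤ; +_; -_; -[1+_]; _*_; ∣_∣) renaming (_+_ to _+ℤ_)
import Data.Integer.Properties as ℤ
import Data.List as List
open import Data.List
  using (List; []; _∷_; _++_; [_]; map; concatMap; reverse; length; head; foldr; allFin; applyUpTo; take; _ʳ++_)
import Data.List.Properties as L
open import Data.List.Membership.Propositional using (_∈_; find)
open import Data.List.Membership.Propositional.Properties
  using (∈-map⁺; ∈-map⁻; ∈-concatMap⁺; ∈-concatMap⁻; ∈-filter⁺; ∈-filter⁻; ∈-allFin; ∈-tabulate⁺)
open import Data.List.Membership.Propositional.Properties.WithK using (unique∧set⇒bag)
open import Data.List.Relation.Binary.BagAndSetEquality using (∼bag⇒↭)
open import Data.List.Relation.Binary.Disjoint.Propositional using (Disjoint)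
open import Data.List.Relation.Binary.Permutation.Propositional
  using (_↭_; ↭-sym; ↭⇒↭ₛ) renaming (refl to ↭-refl; prep to ↭-prep; swap to ↭-swap; trans to ↭-trans)
import Data.List.Relation.Binary.Permutation.Propositional.Properties as ↭
import Data.List.Relation.Binary.Permutation.Setoid.Properties as ↭ₛ
open import Data.List.Relation.Unary.All using (All; []; _∷_)
import Data.List.Relation.Unary.All as All
import Data.List.Relation.Unary.All.Properties as All
open import Data.List.Relation.Unary.AllPairs using ([]; _∷_)
import Data.List.Relation.Unary.AllPairs as AllPairs
import Data.List.Relation.Unary.AllPairs.Properties as AllPairs
open import Data.List.Relation.Unary.Any using (here; there)
import Data.List.Relation.Unary.Any as Any
open import Data.List.Relation.Unary.Unique.Propositional using (Unique)
import Data.List.Relation.Unary.Unique.Propositional.Properties as Unique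
open import Data.Maybe using (just)
open import Data.Nat using (ℕ; zero; suc; _+_; _<ᵇ_; _%_; ⌊_/2⌋; s≤s)
open import Data.Nat.DivMod using (_mod_)
import Data.Nat.DivMod as DivMod
open import Data.Nat.ListAction using (sum)
import Data.Nat.ListAction.Properties as Sum
import Data.Nat.Properties as ℕ
open import Data.Nat.Tactic.RingSolver using (solve-∀)
open import Data.Product using (_×_; _,_; proj₁; proj₂; ∃; ∃₂; map₂)
open import Data.Sum using (_⊎_; inj₁; inj₂)
import Data.Sum
open import Data.Unit using (⊤; tt)
open import Data.Vec using (Vec; lookup; toList; tabulate)
import Data.Vec as Vec
import Data.Vec.Properties as Vec
open import Data.Vec.Relation.Binary.Equality.Cast using (cast-is-id)
open import Function using (_∘_)
open import Function.Bundles using (mk⇔; _⇔_; Equivalence)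
open import Function.Definitions using (Injective)
open import Relation.Binary.Definitions using (tri<; tri≈; tri>)
open import Relation.Binary.PropositionalEquality hiding ([_])
open import Relation.Nullary using (Dec; yes; no; does; contradiction)
open import Relation.Nullary.Decidable using (dec-true; dec-false; decidable-stable; ¬?; _×-dec_)

open import Algebra.Properties.CommutativeSemigroup ℕ.+-commutativeSemigroup
  using () renaming (interchange to +-interchange)
open import Algebra.Properties.CommutativeSemigroup (CommutativeRing.+-commutativeSemigroup B.xor-∧-commutativeRing)
  using () renaming (interchange to xor-interchange)

bit : Bool → ℕ
bit true  = 1
bit false = 0

odd : ℕ → Bool
odd zero    = false
odd (suc n) = not (odd n)

odd-+ : ∀ m n → odd (m + n) ≡ odd m xor odd n
odd-+ zero    n = refl
odd-+ (suc m) n = trans (cong not (odd-+ m n)) (B.not-distribˡ-xor (odd m) (odd n))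

odd-bit : ∀ b → odd (bit b) ≡ b
odd-bit true  = refl
odd-bit false = refl

isEvenᵇ≡not-odd : ∀ k → isEvenᵇ k ≡ not (odd k)
isEvenᵇ≡not-odd zero          = refl
isEvenᵇ≡not-odd (suc zero)    = refl
isEvenᵇ≡not-odd (suc (suc k)) =  -- suc (suc k) % 2 computes to k % 2
  trans (isEvenᵇ≡not-odd k) (cong not (sym (B.not-involutive (odd k))))

xor≡false⇒≡ : ∀ {x y} → x xor y ≡ false → x ≡ y
xor≡false⇒≡ {true}  {true}  _ = refl
xor≡false⇒≡ {false} {false} _ = refl

xor-transpose : ∀ a b c d → a xor b ≡ c xor d → a xor c ≡ b xor d
xor-transpose a b c d e = xor≡false⇒≡ (begin
  (a xor c) xor (b xor d)    ≡⟨ xor-interchange a b c d ⟨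
  (a xor b) xor (c xor d)    ≡⟨ cong (_xor (c xor d)) e ⟩
  (c xor d) xor (c xor d)    ≡⟨ B.xor-same (c xor d) ⟩
  false                      ∎)
  where open ≡-Reasoning

sign : Bool → ℤ
sign false = + 1
sign true  = - + 1

sign-not : ∀ b → sign (not b) ≡ - sign b
sign-not true  = refl
sign-not false = refl

signPow≡sign-odd : ∀ k → signPow k ≡ sign (odd k)
signPow≡sign-odd zero    = refl
signPow≡sign-odd (suc k) = trans (cong -_ (signPow≡sign-odd k)) (sym (sign-not (odd k)))

sign-xor : ∀ a b → sign (a xor b) ≡ sign a * sign b
sign-xor true  true  = refl
sign-xor true  false = refl
sign-xor false b     = sym (ℤ.*-identityˡ (sign b))

signPow-+ : ∀ a b → signPow (a + b) ≡ signPow a * signPow b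
signPow-+ a b = begin
  signPow (a + b)                   ≡⟨ signPow≡sign-odd (a + b) ⟩
  sign (odd (a + b))                ≡⟨ cong sign (odd-+ a b) ⟩
  sign (odd a xor odd b)            ≡⟨ sign-xor (odd a) (odd b) ⟩
  sign (odd a) * sign (odd b)       ≡⟨ cong₂ _*_ (signPow≡sign-odd a) (signPow≡sign-odd b) ⟨
  signPow a * signPow b             ∎
  where open ≡-Reasoning

signPow-complement : ∀ a b → odd (a + b) ≡ true → signPow b ≡ - signPow a
signPow-complement a b odd-ab = begin
  signPow b             ≡⟨ signPow≡sign-odd b ⟩
  sign (odd b)          ≡⟨ cong sign (complement (odd a) (odd b) (trans (sym (odd-+ a b)) odd-ab)) ⟩
  sign (not (odd a))    ≡⟨ sign-not (odd a) ⟩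
  - sign (odd a)        ≡⟨ cong -_ (signPow≡sign-odd a) ⟨
  - signPow a           ∎
  where
  open ≡-Reasoning
  complement : ∀ x y → x xor y ≡ true → y ≡ not x
  complement true  false _ = refl
  complement false true  _ = refl

signPow-*-sign : ∀ c b e → signPow c * (sign b * e) ≡ sign (odd c xor b) * e
signPow-*-sign c b e = begin
  signPow c * (sign b * e)              ≡⟨ ℤ.*-assoc (signPow c) (sign b) e ⟨
  (signPow c * sign b) * e              ≡⟨ cong (λ s → (s * sign b) * e) (signPow≡sign-odd c) ⟩
  (sign (odd c) * sign b) * e           ≡⟨ cong (_* e) (sign-xor (odd c) b) ⟨
  sign (odd c xor b) * e                ∎
  where open ≡-Reasoning

bit-∧ : ∀ a b → + bit (a ∧ b) ≡ + bit a * + bit b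
bit-∧ true  b = sym (ℤ.*-identityˡ (+ bit b))
bit-∧ false b = refl

⌊+double/2⌋ : ∀ m c → ⌊ m + (c + c) /2⌋ ≡ ⌊ m /2⌋ + c
⌊+double/2⌋ m zero    = trans (cong ⌊_/2⌋ (ℕ.+-identityʳ m)) (sym (ℕ.+-identityʳ _))
⌊+double/2⌋ m (suc c) = trans (cong ⌊_/2⌋ (shift m c)) (trans (cong suc (⌊+double/2⌋ m c)) (sym (ℕ.+-suc _ c)))
  where
  shift : ∀ m c → m + (suc c + suc c) ≡ suc (suc (m + (c + c)))
  shift = solve-∀

does-true : ∀ {P : Set} (p? : Dec P) → does p? ≡ true → P
does-true (yes p) _ = p

module _ {A : Set} where

  count-∷ : ∀ (p : A → Bool) x xs → count p (x ∷ xs) ≡ bit (p x) + count p xs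
  count-∷ p x xs with p x
  ... | true  = refl
  ... | false = refl

  count-cong : ∀ {p q : A → Bool} xs → (∀ {x} → x ∈ xs → p x ≡ q x) → count p xs ≡ count q xs
  count-cong []       _ = refl
  count-cong {p} {q} (x ∷ xs) p≗q = begin
    count p (x ∷ xs)          ≡⟨ count-∷ p x xs ⟩
    bit (p x) + count p xs    ≡⟨ cong₂ _+_ (cong bit (p≗q (here refl))) (count-cong xs (p≗q ∘ there)) ⟩
    bit (q x) + count q xs    ≡⟨ count-∷ q x xs ⟨
    count q (x ∷ xs)          ∎
    where open ≡-Reasoning

  count-↭ : ∀ (p : A → Bool) {xs ys} → xs ↭ ys → count p xs ≡ count p ys
  count-↭ p xs↭ys = ↭.↭-length (↭.filter-↭ (λ x → p x B.≟ true) xs↭ys)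

  count-++ : ∀ (p : A → Bool) xs ys → count p (xs ++ ys) ≡ count p xs + count p ys
  count-++ p xs ys = trans (cong length (L.filter-++ _ xs ys)) (L.length-++ (List.filter _ xs))

  odd-count-∷ : ∀ (p : A → Bool) x xs → odd (count p (x ∷ xs)) ≡ p x xor odd (count p xs)
  odd-count-∷ p x xs = trans (cong odd (count-∷ p x xs)) (trans (odd-+ (bit (p x)) _) (cong (_xor _) (odd-bit (p x))))

  count-reverse : ∀ (p : A → Bool) xs → count p (reverse xs) ≡ count p xs
  count-reverse p xs = count-↭ p (↭.↭-reverse xs)

  count-+ : ∀ (p q r : A → Bool) → (∀ x → bit (p x) + bit (q x) ≡ bit (r x)) →
            ∀ xs → count p xs + count q xs ≡ count r xs
  count-+ p q r pq≡r []       = refl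
  count-+ p q r pq≡r (x ∷ xs) = begin
    count p (x ∷ xs) + count q (x ∷ xs)                      ≡⟨ cong₂ _+_ (count-∷ p x xs) (count-∷ q x xs) ⟩
    (bit (p x) + count p xs) + (bit (q x) + count q xs)      ≡⟨ +-interchange (bit (p x)) _ _ _ ⟩
    (bit (p x) + bit (q x)) + (count p xs + count q xs)      ≡⟨ cong₂ _+_ (pq≡r x) (count-+ p q r pq≡r xs) ⟩
    bit (r x) + count r xs                                   ≡⟨ count-∷ r x xs ⟨
    count r (x ∷ xs)                                         ∎
    where open ≡-Reasoning

  odd-count-xor : ∀ (p q : A → Bool) xs →
                  odd (count (λ x → p x xor q x) xs) ≡ odd (count p xs) xor odd (count q xs)
  odd-count-xor p q []       = refl
  odd-count-xor p q (x ∷ xs) = begin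
    odd (count (λ x → p x xor q x) (x ∷ xs))                 ≡⟨ odd-count-∷ (λ x → p x xor q x) x xs ⟩
    (p x xor q x) xor odd (count (λ x → p x xor q x) xs)     ≡⟨ cong ((p x xor q x) xor_) (odd-count-xor p q xs) ⟩
    (p x xor q x) xor (odd (count p xs) xor odd (count q xs)) ≡⟨ xor-interchange (p x) (q x) _ _ ⟩
    (p x xor odd (count p xs)) xor (q x xor odd (count q xs)) ≡⟨ cong₂ _xor_ (odd-count-∷ p x xs) (odd-count-∷ q x xs) ⟨
    odd (count p (x ∷ xs)) xor odd (count q (x ∷ xs))         ∎
    where open ≡-Reasoning

  count-false : ∀ (xs : List A) → count (λ _ → false) xs ≡ 0
  count-false []       = refl
  count-false (_ ∷ xs) = count-false xs

  count-tabulate : ∀ {m} (p : A → Bool) (h : Fin m → A) →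
                   count p (List.tabulate h) ≡ sum (List.tabulate (λ i → bit (p (h i))))
  count-tabulate {zero}  p h = refl
  count-tabulate {suc m} p h = trans (count-∷ p (h Fin.zero) _) (cong₂ _+_ refl (count-tabulate p (h ∘ Fin.suc)))

count-map : ∀ {A B : Set} (p : B → Bool) (f : A → B) xs → count p (map f xs) ≡ count (λ x → p (f x)) xs
count-map p f []       = refl
count-map p f (x ∷ xs) =
  trans (count-∷ p (f x) (map f xs)) (trans (cong₂ _+_ refl (count-map p f xs)) (sym (count-∷ (λ x → p (f x)) x xs)))

sum-tabulate-+ : ∀ {m} (a b : Fin m → ℕ) →
                 sum (List.tabulate (λ i → a i + b i)) ≡ sum (List.tabulate a) + sum (List.tabulate b)
sum-tabulate-+ {zero}  a b = refl
sum-tabulate-+ {suc m} a b =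
  trans (cong₂ _+_ refl (sum-tabulate-+ (a ∘ Fin.suc) (b ∘ Fin.suc))) (+-interchange (a Fin.zero) (b Fin.zero) _ _)

∑ : ∀ {A : Set} → List A → (A → ℤ) → ℤ
∑ xs f = sumℤ (map f xs)

syntax ∑ xs (λ x → e) = ∑[ x ← xs ] e

module _ {A : Set} where

  ∑-cong : ∀ xs {f g : A → ℤ} → (∀ {x} → x ∈ xs → f x ≡ g x) → ∑ xs f ≡ ∑ xs g
  ∑-cong []       _   = refl
  ∑-cong (x ∷ xs) f≗g = cong₂ _+ℤ_ (f≗g (here refl)) (∑-cong xs (λ x∈ → f≗g (there x∈)))

  ∑-++ : ∀ xs ys (f : A → ℤ) → ∑ (xs ++ ys) f ≡ ∑ xs f +ℤ ∑ ys f
  ∑-++ []       ys f = sym (ℤ.+-identityˡ (∑ ys f))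
  ∑-++ (x ∷ xs) ys f = trans (cong (f x +ℤ_) (∑-++ xs ys f)) (sym (ℤ.+-assoc (f x) _ _))

  ∑-↭ : ∀ {xs ys} (f : A → ℤ) → xs ↭ ys → ∑ xs f ≡ ∑ ys f
  ∑-↭ {A} f p = ↭ₛ.foldr-commMonoid (setoid ℤ) ℤ.+-0-isCommutativeMonoid (↭⇒↭ₛ (↭.map⁺ f p))

  ∑-*ˡ : ∀ xs c (f : A → ℤ) → ∑[ x ← xs ] (c * f x) ≡ c * ∑ xs f
  ∑-*ˡ []       c f = sym (ℤ.*-zeroʳ c)
  ∑-*ˡ (x ∷ xs) c f = trans (cong (c * f x +ℤ_) (∑-*ˡ xs c f)) (sym (ℤ.*-distribˡ-+ c (f x) _))

  ∑-neg : ∀ xs (f : A → ℤ) → ∑[ x ← xs ] (- f x) ≡ - ∑ xs f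
  ∑-neg []       f = refl
  ∑-neg (x ∷ xs) f = trans (cong (- f x +ℤ_) (∑-neg xs f)) (sym (ℤ.neg-distrib-+ (f x) _))

  ∑-zero : ∀ (xs : List A) → ∑[ x ← xs ] (+ 0) ≡ + 0
  ∑-zero []       = refl
  ∑-zero (x ∷ xs) = trans (ℤ.+-identityˡ _) (∑-zero xs)

  count≡∑ : ∀ (p : A → Bool) xs → + count p xs ≡ ∑[ x ← xs ] (+ bit (p x))
  count≡∑ p []       = refl
  count≡∑ p (x ∷ xs) =
    trans (cong +_ (count-∷ p x xs)) (trans (ℤ.pos-+ (bit (p x)) _) (cong (+ bit (p x) +ℤ_) (count≡∑ p xs)))

module _ {A B : Set} where

  ∑-map : ∀ (g : A → B) xs (f : B → ℤ) → ∑ (map g xs) f ≡ ∑[ x ← xs ] f (g x)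
  ∑-map g xs f = cong sumℤ (sym (L.map-∘ xs))

  ∑-concatMap : ∀ (g : A → List B) xs (f : B → ℤ) → ∑ (concatMap g xs) f ≡ ∑[ x ← xs ] ∑ (g x) f
  ∑-concatMap g []       f = refl
  ∑-concatMap g (x ∷ xs) f = trans (∑-++ (g x) _ f) (cong (∑ (g x) f +ℤ_) (∑-concatMap g xs f))

pairCount : ∀ {A : Set} → (A → A → Bool) → List A → ℕ
pairCount K []       = 0
pairCount K (x ∷ xs) = count (K x) xs + pairCount K xs

edgesIn≡pairCount : ∀ {n} (G : Graph n) xs → edgesIn G xs ≡ pairCount (adj G) xs
edgesIn≡pairCount G []       = refl
edgesIn≡pairCount G (x ∷ xs) = cong₂ _+_ refl (edgesIn≡pairCount G xs)

module _ {A : Set} (K : A → A → Bool) where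

  pairCount-snoc : ∀ xs z → pairCount K (xs ++ [ z ]) ≡ pairCount K xs + count (λ x → K x z) xs
  pairCount-snoc []       z = refl
  pairCount-snoc (x ∷ xs) z = begin
    count (K x) (xs ++ [ z ]) + pairCount K (xs ++ [ z ])
      ≡⟨ cong₂ _+_ (trans (count-++ (K x) xs [ z ]) (cong₂ _+_ refl (trans (count-∷ (K x) z []) (ℕ.+-identityʳ _))))
                   (pairCount-snoc xs z) ⟩
    (count (K x) xs + bit (K x z)) + (pairCount K xs + count (λ x → K x z) xs)
      ≡⟨ +-interchange (count (K x) xs) (bit (K x z)) (pairCount K xs) _ ⟩
    (count (K x) xs + pairCount K xs) + (bit (K x z) + count (λ x → K x z) xs)
      ≡⟨ cong₂ _+_ refl (count-∷ (λ x → K x z) x xs) ⟨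
    pairCount K (x ∷ xs) + count (λ x → K x z) (x ∷ xs) ∎
    where open ≡-Reasoning

  pairCount-reverse : ∀ xs → pairCount K (reverse xs) ≡ pairCount (λ x y → K y x) xs
  pairCount-reverse []       = refl
  pairCount-reverse (x ∷ xs) = begin
    pairCount K (reverse (x ∷ xs))                                   ≡⟨ cong (pairCount K) (L.unfold-reverse x xs) ⟩
    pairCount K (reverse xs ++ [ x ])                                ≡⟨ pairCount-snoc (reverse xs) x ⟩
    pairCount K (reverse xs) + count (λ y → K y x) (reverse xs)      ≡⟨ cong₂ _+_ (pairCount-reverse xs) (count-reverse _ xs) ⟩
    pairCount (λ x y → K y x) xs + count (λ y → K y x) xs            ≡⟨ ℕ.+-comm _ (count (λ y → K y x) xs) ⟩
    pairCount (λ x y → K y x) (x ∷ xs)                               ∎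
    where open ≡-Reasoning

  pairCount-↭ : (∀ x y → K x y ≡ K y x) → ∀ {xs ys} → xs ↭ ys → pairCount K xs ≡ pairCount K ys
  pairCount-↭ K-sym ↭-refl = refl
  pairCount-↭ K-sym (↭-prep x p) = cong₂ _+_ (count-↭ (K x) p) (pairCount-↭ K-sym p)
  pairCount-↭ K-sym (↭-swap {xs} {ys} x y p) = begin
    count (K x) (y ∷ xs) + (count (K y) xs + pairCount K xs)
      ≡⟨ cong₂ _+_ (count-∷ (K x) y xs) (cong₂ _+_ (count-↭ (K y) p) (pairCount-↭ K-sym p)) ⟩
    (bit (K x y) + count (K x) xs) + (count (K y) ys + pairCount K ys)
      ≡⟨ cong (λ b → (bit b + count (K x) xs) + (count (K y) ys + pairCount K ys)) (K-sym x y) ⟩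
    (bit (K y x) + count (K x) xs) + (count (K y) ys + pairCount K ys)
      ≡⟨ cong (λ c → (bit (K y x) + c) + (count (K y) ys + pairCount K ys)) (count-↭ (K x) p) ⟩
    (bit (K y x) + count (K x) ys) + (count (K y) ys + pairCount K ys)
      ≡⟨ +-interchange (bit (K y x)) (count (K x) ys) _ _ ⟩
    (bit (K y x) + count (K y) ys) + (count (K x) ys + pairCount K ys)
      ≡⟨ cong₂ _+_ (count-∷ (K y) x ys) refl ⟨
    count (K y) (x ∷ ys) + (count (K x) ys + pairCount K ys) ∎
    where open ≡-Reasoning
  pairCount-↭ K-sym (↭-trans p q) = trans (pairCount-↭ K-sym p) (pairCount-↭ K-sym q)

pairCount-+ : ∀ {A : Set} (K L M : A → A → Bool) → (∀ x y → bit (K x y) + bit (L x y) ≡ bit (M x y)) →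
              ∀ xs → pairCount K xs + pairCount L xs ≡ pairCount M xs
pairCount-+ K L M KL≡M []       = refl
pairCount-+ K L M KL≡M (x ∷ xs) = begin
  (count (K x) xs + pairCount K xs) + (count (L x) xs + pairCount L xs)
    ≡⟨ +-interchange (count (K x) xs) _ _ _ ⟩
  (count (K x) xs + count (L x) xs) + (pairCount K xs + pairCount L xs)
    ≡⟨ cong₂ _+_ (count-+ (K x) (L x) (M x) (KL≡M x) xs) (pairCount-+ K L M KL≡M xs) ⟩
  count (M x) xs + pairCount M xs ∎
  where open ≡-Reasoning

module _ {A : Set} where

  unique-↭ : ∀ {xs ys : List A} → Unique xs → Unique ys →
             (∀ {x} → x ∈ xs → x ∈ ys) → (∀ {x} → x ∈ ys → x ∈ xs) → xs ↭ ys
  unique-↭ xs! ys! xs⊆ys ys⊆xs = ∼bag⇒↭ (unique∧set⇒bag xs! ys! (mk⇔ xs⊆ys ys⊆xs))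

  Unique-resp-↭ : ∀ {xs ys : List A} → xs ↭ ys → Unique xs → Unique ys
  Unique-resp-↭ p = ↭ₛ.Unique-resp-↭ (setoid A) (↭⇒↭ₛ p)

  involution-↭ : ∀ (f : A → A) {xs} → Unique xs → (∀ {x} → x ∈ xs → f x ∈ xs) →
                 (∀ {x} → x ∈ xs → f (f x) ≡ x) → map f xs ↭ xs
  involution-↭ f {xs} xs! f∈ ff≡ = unique-↭ (map-unique xs! (λ {_} {_} → injective-on)) xs! image∈ (λ {x} x∈ →
      subst (_∈ map f xs) (ff≡ x∈) (∈-map⁺ f (f∈ x∈)))
    where
    injective-on : ∀ {x y} → x ∈ xs → y ∈ xs → f x ≡ f y → x ≡ y
    injective-on x∈ y∈ e = trans (sym (ff≡ x∈)) (trans (cong f e) (ff≡ y∈))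
    image∈ : ∀ {y} → y ∈ map f xs → y ∈ xs
    image∈ y∈ with ∈-map⁻ f y∈
    ... | x , x∈ , refl = f∈ x∈
    map-unique : ∀ {ys} → Unique ys → (∀ {x y} → x ∈ ys → y ∈ ys → f x ≡ f y → x ≡ y) → Unique (map f ys)
    map-unique []            _   = []
    map-unique (x∉ys ∷ ys!) inj =
      All.map⁺ (All.tabulate (λ y∈ fx≡fy → All.lookup x∉ys y∈ (inj (here refl) (there y∈) fx≡fy)))
      ∷ map-unique ys! (λ x∈ y∈ → inj (there x∈) (there y∈))

module _ {A B C : Set} where

  concatMap-unique : ∀ (f : A → List B) (tag : B → C) (t : A → C) →
                     (∀ {x b} → b ∈ f x → tag b ≡ t x) →
                     ∀ {xs} → Unique (map t xs) → All (Unique ∘ f) xs → Unique (concatMap f xs)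
  concatMap-unique f tag t tagged t! f! =
    Unique.concat⁺ (All.map⁺ f!) (AllPairs.map⁺ (AllPairs.map disjoint (AllPairs.map⁻ t!)))
    where
    disjoint : ∀ {x y} → t x ≢ t y → Disjoint (f x) (f y)
    disjoint tx≢ty (b∈fx , b∈fy) = tx≢ty (trans (sym (tagged b∈fx)) (tagged b∈fy))

module _ {A : Set} where

  select : List A → List (A × List A)
  select []       = []
  select (x ∷ xs) = (x , xs) ∷ map (map₂ (x ∷_)) (select xs)

  select-↭ : ∀ xs {y ys} → (y , ys) ∈ select xs → xs ↭ y ∷ ys
  select-↭ (x ∷ xs) (here refl) = ↭-refl
  select-↭ (x ∷ xs) (there p∈) with ∈-map⁻ (map₂ (x ∷_)) p∈
  ... | (y , ys) , p∈′ , refl = ↭-trans (↭-prep x (select-↭ xs p∈′)) (↭-swap x y ↭-refl)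

  select-complete : ∀ {xs y} → y ∈ xs → ∃ λ ys → (y , ys) ∈ select xs
  select-complete (here refl) = _ , here refl
  select-complete {x ∷ xs} (there y∈) with select-complete y∈
  ... | ys , p∈ = x ∷ ys , there (∈-map⁺ (map₂ (x ∷_)) p∈)

  map-proj₁-select : ∀ xs → map proj₁ (select xs) ≡ xs
  map-proj₁-select []       = refl
  map-proj₁-select (x ∷ xs) = cong (x ∷_) (trans (sym (L.map-∘ (select xs))) (map-proj₁-select xs))

  select-unique : ∀ {xs y ys} → Unique xs → (y , ys) ∈ select xs → Unique ys
  select-unique {xs} xs! p∈ = AllPairs.tail (Unique-resp-↭ (select-↭ xs p∈) xs!)

  -- permutations k xs lists the orderings of xs when xs has length k, and is empty otherwise
  permutations : ℕ → List A → List (List A)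
  consPermutations : ℕ → A × List A → List (List A)

  permutations zero    []      = [ [] ]
  permutations zero    (_ ∷ _) = []
  permutations (suc k) xs      = concatMap (consPermutations k) (select xs)

  consPermutations k (y , ys) = map (y ∷_) (permutations k ys)

  ∈-permutations⁻ : ∀ k xs {ρ} → ρ ∈ permutations k xs → ρ ↭ xs × length xs ≡ k
  ∈-permutations⁻ zero    []  (here refl) = ↭-refl , refl
  ∈-permutations⁻ (suc k) xs ρ∈ with find (∈-concatMap⁻ (consPermutations k) {xs = select xs} ρ∈)
  ... | (y , ys) , p∈ , ρ∈′ with ∈-map⁻ (y ∷_) ρ∈′
  ... | ρ′ , ρ′∈ , refl with ∈-permutations⁻ k ys ρ′∈
  ... | ρ′↭ys , refl = ↭-trans (↭-prep y ρ′↭ys) (↭-sym (select-↭ xs p∈)) , ↭.↭-length (select-↭ xs p∈)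

  ∈-permutations⁺ : ∀ k xs {ρ} → ρ ↭ xs → length xs ≡ k → ρ ∈ permutations k xs
  ∈-permutations⁺ zero    []       {[]}    _   _   = here refl
  ∈-permutations⁺ zero    []       {_ ∷ _} ρ↭xs _  with () ← ↭.↭-length ρ↭xs
  ∈-permutations⁺ (suc k) xs       {[]}    ρ↭xs len with () ← trans (↭.↭-length ρ↭xs) len
  ∈-permutations⁺ (suc k) xs       {y ∷ ρ} ρ↭xs len with select-complete (↭.∈-resp-↭ ρ↭xs (here refl))
  ... | ys , p∈ = ∈-concatMap⁺ (consPermutations k) {xs = select xs} (Any.map (λ { refl → ρ∈ }) p∈)
    where
    ρ∈ : y ∷ ρ ∈ consPermutations k (y , ys)
    ρ∈ = ∈-map⁺ (y ∷_) (∈-permutations⁺ k ys (↭.drop-∷ (↭-trans ρ↭xs (select-↭ xs p∈)))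
                          (ℕ.suc-injective (trans (sym (↭.↭-length (select-↭ xs p∈))) len)))

  permutations-unique : ∀ k {xs} → Unique xs → Unique (permutations k xs)
  permutations-unique zero    {[]}    _   = [] ∷ []
  permutations-unique zero    {_ ∷ _} _   = []
  permutations-unique (suc k) {xs}    xs! =
    concatMap-unique (consPermutations k) head (just ∘ proj₁) headed
      (subst Unique (sym (trans (L.map-∘ (select xs)) (cong (map just) (map-proj₁-select xs))))
             (Unique.map⁺ (λ { refl → refl }) xs!))
      (All.tabulate (λ { {y , ys} p∈ → Unique.map⁺ (λ { refl → refl }) (permutations-unique k (select-unique xs! p∈)) }))
    where
    headed : ∀ {p ρ} → ρ ∈ consPermutations k p → head ρ ≡ just (proj₁ p)
    headed ρ∈ with ∈-map⁻ _ ρ∈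
    ... | _ , _ , refl = refl

  permutations-reverse : ∀ k {xs} → Unique xs → map reverse (permutations k xs) ↭ permutations k xs
  permutations-reverse k {xs} xs! =
    unique-↭ (Unique.map⁺ L.reverse-injective perms!) perms! reversed∈ (λ {ρ} ρ∈ →
      subst (_∈ map reverse (permutations k xs)) (L.reverse-involutive ρ) (∈-map⁺ reverse (reversed∈ (∈-map⁺ reverse ρ∈))))
    where
    perms! : Unique (permutations k xs)
    perms! = permutations-unique k xs!
    reversed∈ : ∀ {ρ} → ρ ∈ map reverse (permutations k xs) → ρ ∈ permutations k xs
    reversed∈ ρ∈ with ∈-map⁻ reverse ρ∈
    ... | σ , σ∈ , refl with ∈-permutations⁻ k xs σ∈
    ... | σ↭xs , len = ∈-permutations⁺ k xs (↭-trans (↭.↭-reverse σ) σ↭xs) len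

module _ {A : Set} where

  count-agree-off-two : ∀ (f g : A → Bool) {L i j} → Unique L → i ∈ L → j ∈ L → i ≢ j →
                        (∀ {b} → b ∈ L → b ≢ i → b ≢ j → f b ≡ g b) →
                        count f L + (bit (g i) + bit (g j)) ≡ count g L + (bit (f i) + bit (f j))
  count-agree-off-two f g {L} {i} {j} L! i∈ j∈ i≢j agree with select-complete i∈
  ... | L₁ , s₁ with ↭.∈-resp-↭ (select-↭ L s₁) j∈
  ...   | here j≡i = contradiction (sym j≡i) i≢j
  ...   | there j∈L₁ with select-complete j∈L₁
  ...     | L₂ , s₂ = begin
    count f L + (bit (g i) + bit (g j))
      ≡⟨ cong (_+ (bit (g i) + bit (g j))) (split f) ⟩
    (bit (f i) + (bit (f j) + count f L₂)) + (bit (g i) + bit (g j))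
      ≡⟨ cong (λ c → (bit (f i) + (bit (f j) + c)) + (bit (g i) + bit (g j))) (count-cong L₂ agree-on-L₂) ⟩
    (bit (f i) + (bit (f j) + count g L₂)) + (bit (g i) + bit (g j))
      ≡⟨ rearrange (bit (f i)) (bit (f j)) (count g L₂) (bit (g i)) (bit (g j)) ⟩
    (bit (g i) + (bit (g j) + count g L₂)) + (bit (f i) + bit (f j))
      ≡⟨ cong (_+ (bit (f i) + bit (f j))) (split g) ⟨
    count g L + (bit (f i) + bit (f j)) ∎
    where
    open ≡-Reasoning
    L↭ : L ↭ i ∷ j ∷ L₂
    L↭ = ↭-trans (select-↭ L s₁) (↭-prep i (select-↭ L₁ s₂))
    split : ∀ h → count h L ≡ bit (h i) + (bit (h j) + count h L₂)
    split h = trans (count-↭ h L↭) (trans (count-∷ h i (j ∷ L₂)) (cong₂ _+_ refl (count-∷ h j L₂)))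
    agree-on-L₂ : ∀ {b} → b ∈ L₂ → f b ≡ g b
    agree-on-L₂ b∈ with Unique-resp-↭ L↭ L!
    ... | (i∉ ∷ (j∉ ∷ _)) =
      agree (↭.∈-resp-↭ (↭-sym L↭) (there (there b∈))) (λ b≡i → All.lookup i∉ (there b∈) (sym b≡i))
            (λ b≡j → All.lookup j∉ b∈ (sym b≡j))
    rearrange : ∀ a b c d e → (a + (b + c)) + (d + e) ≡ (d + (e + c)) + (a + b)
    rearrange = solve-∀

∑-permutations-suc : ∀ {A : Set} k xs (f : List A → ℤ) →
  ∑ (permutations (suc k) xs) f ≡ ∑[ p ← select xs ] ∑[ ρ ← permutations k (proj₂ p) ] f (proj₁ p ∷ ρ)
∑-permutations-suc k xs f =
  trans (∑-concatMap (consPermutations k) (select xs) f)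
        (∑-cong (select xs) (λ { {y , ys} _ → ∑-map (y ∷_) (permutations k ys) f }))

module _ {m : ℕ} where

  private
    occurs : Fin m → List (Fin m) → Bool
    occurs x xs = foldr (λ y b → does (x ≟ y) ∨ b) false xs

    ¬occurs⇒All≢ : ∀ x xs → occurs x xs ≡ false → All (x ≢_) xs
    ¬occurs⇒All≢ x []       _ = []
    ¬occurs⇒All≢ x (y ∷ xs) e with x ≟ y
    ... | yes _   with () ← e
    ... | no x≢y  = x≢y ∷ ¬occurs⇒All≢ x xs e

    All≢⇒¬occurs : ∀ x xs → All (x ≢_) xs → occurs x xs ≡ false
    All≢⇒¬occurs x []       []            = refl
    All≢⇒¬occurs x (y ∷ xs) (x≢y ∷ x∉xs) rewrite dec-false (x ≟ y) x≢y = All≢⇒¬occurs x xs x∉xs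

  allDistinct⇒Unique : ∀ xs → allDistinct xs ≡ true → Unique xs
  allDistinct⇒Unique []       _ = []
  allDistinct⇒Unique (x ∷ xs) e with occurs x xs in eₓ
  ... | false = ¬occurs⇒All≢ x xs eₓ ∷ allDistinct⇒Unique xs e

  Unique⇒allDistinct : ∀ xs → Unique xs → allDistinct xs ≡ true
  Unique⇒allDistinct []       _             = refl
  Unique⇒allDistinct (x ∷ xs) (x∉xs ∷ xs!) rewrite All≢⇒¬occurs x xs x∉xs = Unique⇒allDistinct xs xs!

  ∈-allVecs : ∀ {k} (v : Vec (Fin m) k) → v ∈ allVecs k
  ∈-allVecs Vec.[]            = here refl
  ∈-allVecs {suc k} (x Vec.∷ v) =
    ∈-concatMap⁺ (λ x → map (x Vec.∷_) (allVecs k)) {xs = allFin m}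
      (Any.map (λ { refl → ∈-map⁺ (x Vec.∷_) (∈-allVecs v) }) (∈-allFin x))

  allVecs-unique : ∀ k → Unique (allVecs {m} k)
  allVecs-unique zero    = [] ∷ []
  allVecs-unique (suc k) =
    concatMap-unique (λ x → map (x Vec.∷_) (allVecs k)) Vec.head (λ x → x) headed
      (subst Unique (sym (L.map-id (allFin m))) (Unique.allFin⁺ m))
      (All.universal (λ _ → Unique.map⁺ Vec.∷-injectiveʳ (allVecs-unique k)) (allFin m))
    where
    headed : ∀ {x v} → v ∈ map (x Vec.∷_) (allVecs k) → Vec.head v ≡ x
    headed v∈ with ∈-map⁻ _ v∈
    ... | _ , _ , refl = refl

module _ {n : ℕ} where

  private
    distinct? : (v : Vec (Fin n) n) → Dec (allDistinct (toList v) ≡ true)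
    distinct? v = allDistinct (toList v) B.≟ true

  ∈-bijections⁻ : ∀ {σ : Vec (Fin n) n} → σ ∈ bijections n → Unique (toList σ)
  ∈-bijections⁻ {σ} σ∈ = allDistinct⇒Unique (toList σ) (proj₂ (∈-filter⁻ distinct? {xs = allVecs n} σ∈))

  ∈-bijections⁺ : ∀ {σ : Vec (Fin n) n} → Unique (toList σ) → σ ∈ bijections n
  ∈-bijections⁺ {σ} σ! = ∈-filter⁺ distinct? (∈-allVecs σ) (Unique⇒allDistinct (toList σ) σ!)

  bijections-unique : Unique (bijections n)
  bijections-unique = Unique.filter⁺ _ (allVecs-unique n)

toList≡tabulate : ∀ {A : Set} {k} (v : Vec A k) → toList v ≡ List.tabulate (lookup v)
toList≡tabulate Vec.[]      = refl
toList≡tabulate (x Vec.∷ v) = cong (x ∷_) (toList≡tabulate v)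

toList-surjective : ∀ {A : Set} {k} (xs : List A) → length xs ≡ k → ∃ λ (v : Vec A k) → toList v ≡ xs
toList-surjective xs refl = Vec.fromList xs , Vec.toList∘fromList xs

Unique-toList⇒lookup-injective : ∀ {A : Set} {k} (v : Vec A k) → Unique (toList v) → Injective _≡_ _≡_ (lookup v)
Unique-toList⇒lookup-injective (x Vec.∷ v) (x∉v ∷ v!) {Fin.zero}  {Fin.zero}  _ = refl
Unique-toList⇒lookup-injective (x Vec.∷ v) (x∉v ∷ v!) {Fin.zero}  {Fin.suc j} e =
  contradiction e (All.lookup x∉v (subst (lookup v j ∈_) (sym (toList≡tabulate v)) (∈-tabulate⁺ j)))
Unique-toList⇒lookup-injective (x Vec.∷ v) (x∉v ∷ v!) {Fin.suc i} {Fin.zero}  e =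
  contradiction (sym e) (All.lookup x∉v (subst (lookup v i ∈_) (sym (toList≡tabulate v)) (∈-tabulate⁺ i)))
Unique-toList⇒lookup-injective (x Vec.∷ v) (x∉v ∷ v!) {Fin.suc i} {Fin.suc j} e =
  cong Fin.suc (Unique-toList⇒lookup-injective v v! e)

lookup-injective⇒Unique-toList : ∀ {A : Set} {k} (v : Vec A k) → Injective _≡_ _≡_ (lookup v) → Unique (toList v)
lookup-injective⇒Unique-toList v inj = subst Unique (sym (toList≡tabulate v)) (Unique.tabulate⁺ inj)

-- a missed value i could be punched out, injecting Fin n into Fin (n ∸ 1)
injective⇒surjective : ∀ {n} {f : Fin n → Fin n} → Injective _≡_ _≡_ f → ∀ i → ∃ λ u → f u ≡ i
injective⇒surjective {suc n} {f} f-inj i with Fin.any? (λ u → f u ≟ i)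
... | yes hit  = hit
... | no  miss = contradiction (Fin.injective⇒≤ punched-injective) ℕ.1+n≰n
  where
  punched : Fin (suc n) → Fin n
  punched u = punchOut {i = i} {j = f u} (λ i≡fu → miss (u , sym i≡fu))
  punched-injective : Injective _≡_ _≡_ punched
  punched-injective {u} {w} e = f-inj (Fin.punchOut-injective {i = i} _ _ e)

module _ {n : ℕ} where

  preimage : Vec (Fin n) n → Fin n → Fin n
  preimage σ i with Fin.any? (λ u → lookup σ u ≟ i)
  ... | yes (u , _) = u
  ... | no  _       = i

  inverse : Vec (Fin n) n → Vec (Fin n) n
  inverse σ = tabulate (preimage σ)

  module _ {σ : Vec (Fin n) n} (σ∈ : σ ∈ bijections n) where

    private
      lookup-injective : Injective _≡_ _≡_ (lookup σ)
      lookup-injective = Unique-toList⇒lookup-injective σ (∈-bijections⁻ σ∈)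

    lookup-preimage : ∀ i → lookup σ (preimage σ i) ≡ i
    lookup-preimage i with Fin.any? (λ u → lookup σ u ≟ i)
    ... | yes (_ , σu≡i) = σu≡i
    ... | no  miss       = contradiction (injective⇒surjective lookup-injective i) miss

    lookup-inverse-lookup : ∀ u → lookup (inverse σ) (lookup σ u) ≡ u
    lookup-inverse-lookup u = lookup-injective (trans (cong (lookup σ) (Vec.lookup∘tabulate _ (lookup σ u)))
                                                      (lookup-preimage (lookup σ u)))

    inverse∈bijections : inverse σ ∈ bijections n
    inverse∈bijections = ∈-bijections⁺ (lookup-injective⇒Unique-toList (inverse σ) λ {i} {j} e →
      trans (sym (lookup-preimage i))
        (trans (cong (lookup σ) (trans (sym (Vec.lookup∘tabulate _ i)) (trans e (Vec.lookup∘tabulate _ j))))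
          (lookup-preimage j)))

    toList↭allFin : toList σ ↭ allFin n
    toList↭allFin = unique-↭ (∈-bijections⁻ σ∈) (Unique.allFin⁺ n) (λ _ → ∈-allFin _) λ {i} _ →
      subst (i ∈_) (sym (toList≡tabulate σ))
        (subst (_∈ List.tabulate (lookup σ)) (lookup-preimage i) (∈-tabulate⁺ (preimage σ i)))

  inverse-involutive : ∀ {σ} → σ ∈ bijections n → inverse (inverse σ) ≡ σ
  inverse-involutive {σ} σ∈ = trans (Vec.tabulate-cong preimage-inverse) (Vec.tabulate∘lookup σ)
    where
    preimage-inverse : ∀ u → preimage (inverse σ) u ≡ lookup σ u
    preimage-inverse u = Unique-toList⇒lookup-injective (inverse σ) (∈-bijections⁻ (inverse∈bijections σ∈))
      (trans (lookup-preimage (inverse∈bijections σ∈) u) (sym (lookup-inverse-lookup σ∈ u)))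

  inverse-↭ : map inverse (bijections n) ↭ bijections n
  inverse-↭ = involution-↭ inverse bijections-unique inverse∈bijections inverse-involutive

  toList-bijections↭permutations : map toList (bijections n) ↭ permutations n (allFin n)
  toList-bijections↭permutations =
    unique-↭ (Unique.map⁺ (λ {σ} {τ} e → trans (sym (cast-is-id refl σ)) (Vec.toList-injective refl σ τ e)) bijections-unique)
      (permutations-unique n (Unique.allFin⁺ n)) toList∈ fromList∈
    where
    toList∈ : ∀ {ρ} → ρ ∈ map toList (bijections n) → ρ ∈ permutations n (allFin n)
    toList∈ ρ∈ with ∈-map⁻ toList ρ∈
    ... | σ , σ∈ , refl = ∈-permutations⁺ n (allFin n) (toList↭allFin σ∈) (L.length-tabulate _)
    fromList∈ : ∀ {ρ} → ρ ∈ permutations n (allFin n) → ρ ∈ map toList (bijections n)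
    fromList∈ {ρ} ρ∈ with ∈-permutations⁻ n (allFin n) ρ∈
    ... | ρ↭allFin , len with toList-surjective ρ (trans (↭.↭-length ρ↭allFin) len)
    ... | σ , refl = ∈-map⁺ toList (∈-bijections⁺ (Unique-resp-↭ (↭-sym ρ↭allFin) (Unique.allFin⁺ n)))

module _ {A : Set} (K : A → A → Bool) where

  -- the ordered pairs of a tabulated list, grouped by the position i of their later entry
  pairCount-tabulate : ∀ {m} (g : Fin m → A) →
    pairCount (λ x y → K y x) (List.tabulate g)
      ≡ sum (List.tabulate (λ i → count (λ j → K (g i) (g j) ∧ (toℕ j <ᵇ toℕ i)) (allFin m)))
  pairCount-tabulate {zero}  g = refl
  pairCount-tabulate {suc m} g = begin
    count (λ x → K x (g₀)) (List.tabulate (g ∘ Fin.suc)) + pairCount (λ x y → K y x) (List.tabulate (g ∘ Fin.suc))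
      ≡⟨ cong₂ _+_ (count-tabulate (λ x → K x g₀) (g ∘ Fin.suc)) (pairCount-tabulate (g ∘ Fin.suc)) ⟩
    sum (List.tabulate (λ i → bit (K (g (Fin.suc i)) g₀))) + sum (List.tabulate (earlier (g ∘ Fin.suc)))
      ≡⟨ sum-tabulate-+ (λ i → bit (K (g (Fin.suc i)) g₀)) (earlier (g ∘ Fin.suc)) ⟨
    sum (List.tabulate (λ i → bit (K (g (Fin.suc i)) g₀) + earlier (g ∘ Fin.suc) i))
      ≡⟨ cong sum (L.tabulate-cong (λ i → sym (earlier-suc i))) ⟩
    sum (List.tabulate (earlier g ∘ Fin.suc))
      ≡⟨ cong (_+ sum (List.tabulate (earlier g ∘ Fin.suc))) (earlier-zero) ⟨
    sum (List.tabulate (earlier g)) ∎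
    where
    open ≡-Reasoning
    g₀ : A
    g₀ = g Fin.zero
    earlier : ∀ {k} → (Fin k → A) → Fin k → ℕ
    earlier {k} h i = count (λ j → K (h i) (h j) ∧ (toℕ j <ᵇ toℕ i)) (allFin k)
    earlier-zero : earlier g Fin.zero ≡ 0
    earlier-zero = trans (count-cong (allFin (suc m)) (λ {j} _ → B.∧-zeroʳ (K g₀ (g j)))) (count-false (allFin (suc m)))
    earlier-suc : ∀ i → earlier g (Fin.suc i) ≡ bit (K (g (Fin.suc i)) g₀) + earlier (g ∘ Fin.suc) i
    earlier-suc i = begin
      earlier g (Fin.suc i)
        ≡⟨ count-∷ P Fin.zero (List.tabulate Fin.suc) ⟩
      bit (K (g (Fin.suc i)) g₀ ∧ true) + count P (List.tabulate Fin.suc)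
        ≡⟨ cong₂ _+_ (cong bit (B.∧-identityʳ _)) (cong (count P) (sym (L.map-tabulate (λ j → j) Fin.suc))) ⟩
      bit (K (g (Fin.suc i)) g₀) + count P (map Fin.suc (allFin m))
        ≡⟨ cong₂ _+_ refl (count-map P Fin.suc (allFin m)) ⟩
      bit (K (g (Fin.suc i)) g₀) + earlier (g ∘ Fin.suc) i ∎
      where
      P : Fin (suc m) → Bool
      P j = K (g (Fin.suc i)) (g j) ∧ (toℕ j <ᵇ suc (toℕ i))

des-inverse : ∀ {n} (D : Digraph n) {π} → π ∈ bijections n → des D (inverse π) ≡ pairCount (λ x y → D y x) (toList π)
des-inverse {n} D {π} π∈ = begin
  sum (map (λ u → count (Q u) (allFin n)) (allFin n))
    ≡⟨ cong sum (L.map-cong (λ u → count-↭ (Q u) (↭-sym (toList↭allFin π∈))) (allFin n)) ⟩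
  sum (map (λ u → count (Q u) (toList π)) (allFin n))
    ≡⟨ Sum.sum-↭ (↭.map⁺ _ (↭-sym (toList↭allFin π∈))) ⟩
  sum (map (λ u → count (Q u) (toList π)) (toList π))
    ≡⟨ cong (λ ρ → sum (map (λ u → count (Q u) ρ) ρ)) (toList≡tabulate π) ⟩
  sum (map (λ u → count (Q u) (List.tabulate g)) (List.tabulate g))
    ≡⟨ cong sum (L.map-tabulate g _) ⟩
  sum (List.tabulate (λ i → count (Q (g i)) (List.tabulate g)))
    ≡⟨ cong sum (L.tabulate-cong reindex) ⟩
  sum (List.tabulate (λ i → count (λ j → D (g i) (g j) ∧ (toℕ j <ᵇ toℕ i)) (allFin n)))
    ≡⟨ pairCount-tabulate D g ⟨
  pairCount (λ x y → D y x) (List.tabulate g)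
    ≡⟨ cong (pairCount (λ x y → D y x)) (toList≡tabulate π) ⟨
  pairCount (λ x y → D y x) (toList π) ∎
  where
  open ≡-Reasoning
  g : Fin n → Fin n
  g = lookup π
  Q : Fin n → Fin n → Bool
  Q u v = D u v ∧ (toℕ (lookup (inverse π) v) <ᵇ toℕ (lookup (inverse π) u))
  reindex : ∀ i → count (Q (g i)) (List.tabulate g) ≡ count (λ j → D (g i) (g j) ∧ (toℕ j <ᵇ toℕ i)) (allFin n)
  reindex i = begin
    count (Q (g i)) (List.tabulate g)    ≡⟨ cong (count (Q (g i))) (L.map-tabulate (λ j → j) g) ⟨
    count (Q (g i)) (map g (allFin n))   ≡⟨ count-map (Q (g i)) g (allFin n) ⟩
    count (Q (g i) ∘ g) (allFin n)
      ≡⟨ count-cong (allFin n) (λ {j} _ → cong₂ (λ a b → D (g i) (g j) ∧ (toℕ a <ᵇ toℕ b))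
                                                 (lookup-inverse-lookup π∈ j) (lookup-inverse-lookup π∈ i)) ⟩
    count (λ j → D (g i) (g j) ∧ (toℕ j <ᵇ toℕ i)) (allFin n) ∎

eulerianAtMinusOne≡∑ : ∀ {n} (D : Digraph n) →
  eulerianAtMinusOne D ≡ ∑[ ρ ← permutations n (allFin n) ] signPow (pairCount (λ x y → D y x) ρ)
eulerianAtMinusOne≡∑ {n} D = begin
  ∑[ σ ← bijections n ] signPow (des D σ)
    ≡⟨ ∑-↭ (signPow ∘ des D) inverse-↭ ⟨
  ∑[ σ ← map inverse (bijections n) ] signPow (des D σ)
    ≡⟨ ∑-map inverse (bijections n) (signPow ∘ des D) ⟩
  ∑[ π ← bijections n ] signPow (des D (inverse π))
    ≡⟨ ∑-cong (bijections n) (cong signPow ∘ des-inverse D) ⟩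
  ∑[ π ← bijections n ] descentSign (toList π)
    ≡⟨ ∑-map toList (bijections n) descentSign ⟨
  ∑ (map toList (bijections n)) descentSign
    ≡⟨ ∑-↭ descentSign toList-bijections↭permutations ⟩
  ∑ (permutations n (allFin n)) descentSign ∎
  where
  open ≡-Reasoning
  descentSign : List (Fin n) → ℤ
  descentSign ρ = signPow (pairCount (λ x y → D y x) ρ)

module _ {n : ℕ} (G : Graph n) where

  edgesIn-↭ : ∀ {xs ys} → xs ↭ ys → edgesIn G xs ≡ edgesIn G ys
  edgesIn-↭ {xs} {ys} p = begin
    edgesIn G xs          ≡⟨ edgesIn≡pairCount G xs ⟩
    pairCount (adj G) xs  ≡⟨ pairCount-↭ (adj G) (Graph.sym G) p ⟩
    pairCount (adj G) ys  ≡⟨ edgesIn≡pairCount G ys ⟨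
    edgesIn G ys          ∎
    where open ≡-Reasoning

  arcs-both-ways : ∀ {D} → IsOrientation G D → ∀ x y → bit (D x y) + bit (D y x) ≡ bit (adj G x y)
  arcs-both-ways {D} (asym , covers) x y with D x y in xy | D y x in yx | covers x y
  ... | true  | true  | _  with () ← trans (sym yx) (asym x y xy)
  ... | true  | false | eq rewrite eq = refl
  ... | false | true  | eq rewrite eq = refl
  ... | false | false | eq rewrite eq = refl

  orientation-xor : ∀ {D} → IsOrientation G D → ∀ x y → D x y xor D y x ≡ adj G x y
  orientation-xor {D} (asym , covers) x y with D x y in xy | D y x in yx | covers x y
  ... | true  | true  | _  with () ← trans (sym yx) (asym x y xy)
  ... | true  | false | eq = sym eq
  ... | false | _     | eq = sym eq

  degree-even : ∀ {S y ys} → S ↭ y ∷ ys → odd (edgesIn G S) ≡ false → odd (edgesIn G ys) ≡ false →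
                odd (count (adj G y) ys) ≡ false
  degree-even {S} {y} {ys} S↭ even-S even-ys = begin
    odd (count (adj G y) ys)                              ≡⟨ B.xor-identityʳ _ ⟨
    odd (count (adj G y) ys) xor false                    ≡⟨ cong (odd (count (adj G y) ys) xor_) even-ys ⟨
    odd (count (adj G y) ys) xor odd (edgesIn G ys)       ≡⟨ odd-+ (count (adj G y) ys) (edgesIn G ys) ⟨
    odd (edgesIn G (y ∷ ys))                              ≡⟨ cong odd (edgesIn-↭ S↭) ⟨
    odd (edgesIn G S)                                     ≡⟨ even-S ⟩
    false                                                 ∎
    where open ≡-Reasoning

  evenSuffixes : List (Fin n) → Bool
  evenSuffixes []      = true
  evenSuffixes (x ∷ ρ) = isEvenᵇ (edgesIn G (x ∷ ρ)) ∧ evenSuffixes ρ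

  private
    evenPrefixes : ∀ {m} → Vec (Fin n) m → List (Fin n) → Bool
    evenPrefixes {m} π ρ = foldr _∧_ true (applyUpTo (λ j → isEvenᵇ (edgesIn G (take (suc j) (toList π) ʳ++ ρ))) m)

    evenSuffixes-ʳ++ : ∀ {m} (π : Vec (Fin n) m) ρ →
                       evenSuffixes (toList π ʳ++ ρ) ≡ evenPrefixes π ρ ∧ evenSuffixes ρ
    evenSuffixes-ʳ++ Vec.[]      ρ = refl
    evenSuffixes-ʳ++ (x Vec.∷ π) ρ =
      trans (evenSuffixes-ʳ++ π (x ∷ ρ)) (∧-middle (evenPrefixes π (x ∷ ρ)) (isEvenᵇ (edgesIn G (x ∷ ρ))) (evenSuffixes ρ))
      where
      ∧-middle : ∀ a b c → a ∧ (b ∧ c) ≡ (b ∧ a) ∧ c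
      ∧-middle a b c = trans (sym (B.∧-assoc a b c)) (cong (_∧ c) (B.∧-comm a b))

  isEvenSequence≡evenSuffixes : ∀ π → isEvenSequence G π ≡ evenSuffixes (reverse (toList π))
  isEvenSequence≡evenSuffixes π = sym (begin
    evenSuffixes (toList π ʳ++ [])       ≡⟨ evenSuffixes-ʳ++ π [] ⟩
    evenPrefixes π [] ∧ true             ≡⟨ B.∧-identityʳ _ ⟩
    evenPrefixes π []                    ≡⟨ cong (foldr _∧_ true) (applyUpTo-cong (λ j → cong isEvenᵇ
                                              (edgesIn-↭ (↭.↭-reverse (take (suc j) (toList π))))) n) ⟩
    isEvenSequence G π                   ∎)
    where
    open ≡-Reasoning
    applyUpTo-cong : ∀ {f g : ℕ → Bool} → (∀ j → f j ≡ g j) → ∀ m → applyUpTo f m ≡ applyUpTo g m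
    applyUpTo-cong f≗g zero    = refl
    applyUpTo-cong f≗g (suc m) = cong₂ _∷_ (f≗g 0) (applyUpTo-cong (f≗g ∘ suc) m)

  η≡count : η G ≡ count evenSuffixes (permutations n (allFin n))
  η≡count = begin
    count (isEvenSequence G) (bijections n)
      ≡⟨ count-cong (bijections n) (λ {π} _ → isEvenSequence≡evenSuffixes π) ⟩
    count (evenSuffixes ∘ reverse ∘ toList) (bijections n)
      ≡⟨ count-map (evenSuffixes ∘ reverse) toList (bijections n) ⟨
    count (evenSuffixes ∘ reverse) (map toList (bijections n))
      ≡⟨ count-↭ (evenSuffixes ∘ reverse) toList-bijections↭permutations ⟩
    count (evenSuffixes ∘ reverse) (permutations n (allFin n))
      ≡⟨ count-map evenSuffixes reverse (permutations n (allFin n)) ⟨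
    count evenSuffixes (map reverse (permutations n (allFin n)))
      ≡⟨ count-↭ evenSuffixes (permutations-reverse n (Unique.allFin⁺ n)) ⟩
    count evenSuffixes (permutations n (allFin n)) ∎
    where open ≡-Reasoning

-- Sign potentials

module Arrangements {n : ℕ} (G : Graph n) where

  evenArrangements : ℕ → List (Fin n) → ℤ
  evenArrangements k S = ∑[ ρ ← permutations k S ] (+ bit (evenSuffixes G ρ))

  evenArrangements-suc : ∀ k S → evenArrangements (suc k) S
    ≡ + bit (not (odd (edgesIn G S))) * ∑[ p ← select S ] evenArrangements k (proj₂ p)
  evenArrangements-suc k S = begin
    evenArrangements (suc k) S
      ≡⟨ ∑-permutations-suc k S _ ⟩
    ∑[ p ← select S ] ∑[ ρ ← permutations k (proj₂ p) ] (+ bit (evenSuffixes G (proj₁ p ∷ ρ)))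
      ≡⟨ ∑-cong (select S) (λ { {y , ys} p∈ → trans (∑-cong (permutations k ys) (λ {ρ} → factor {ρ = ρ} p∈))
                                                      (∑-*ˡ (permutations k ys) evenFactor (+_ ∘ bit ∘ evenSuffixes G)) }) ⟩
    ∑[ p ← select S ] (evenFactor * evenArrangements k (proj₂ p))
      ≡⟨ ∑-*ˡ (select S) evenFactor (λ p → evenArrangements k (proj₂ p)) ⟩
    + bit (not (odd (edgesIn G S))) * ∑[ p ← select S ] evenArrangements k (proj₂ p) ∎
    where
    open ≡-Reasoning
    evenFactor : ℤ
    evenFactor = + bit (not (odd (edgesIn G S)))
    factor : ∀ {y ys ρ} → (y , ys) ∈ select S → ρ ∈ permutations k ys →
             + bit (evenSuffixes G (y ∷ ρ)) ≡ evenFactor * + bit (evenSuffixes G ρ)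
    factor {y} {ys} {ρ} p∈ ρ∈ = begin
      + bit (isEvenᵇ (edgesIn G (y ∷ ρ)) ∧ evenSuffixes G ρ)
        ≡⟨ bit-∧ (isEvenᵇ (edgesIn G (y ∷ ρ))) (evenSuffixes G ρ) ⟩
      + bit (isEvenᵇ (edgesIn G (y ∷ ρ))) * + bit (evenSuffixes G ρ)
        ≡⟨ cong (λ b → + bit b * + bit (evenSuffixes G ρ))
                (trans (isEvenᵇ≡not-odd (edgesIn G (y ∷ ρ))) (cong (not ∘ odd) (edgesIn-↭ G y∷ρ↭S))) ⟩
      evenFactor * + bit (evenSuffixes G ρ) ∎
      where
      y∷ρ↭S : y ∷ ρ ↭ S
      y∷ρ↭S = ↭-trans (↭-prep y (proj₁ (∈-permutations⁻ k ys ρ∈))) (↭-sym (select-↭ S p∈))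

  evenArrangements-odd : ∀ k S → odd (edgesIn G S) ≡ true → evenArrangements k S ≡ + 0
  evenArrangements-odd zero    []      ()
  evenArrangements-odd zero    (_ ∷ _) _     = refl
  evenArrangements-odd (suc k) S       odd-e = trans (evenArrangements-suc k S)
    (cong (λ b → + bit (not b) * ∑[ p ← select S ] evenArrangements k (proj₂ p)) odd-e)

  evenArrangements-even : ∀ k S → odd (edgesIn G S) ≡ false →
                          evenArrangements (suc k) S ≡ ∑[ p ← select S ] evenArrangements k (proj₂ p)
  evenArrangements-even k S even-e = trans (evenArrangements-suc k S)
    (trans (cong (λ b → + bit (not b) * ∑[ p ← select S ] evenArrangements k (proj₂ p)) even-e) (ℤ.*-identityˡ _))

  -- All even arrangements of S have descent parity potential S; only Good sets can have even arrangements.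
  record SignPotential (D : Digraph n) : Set₁ where
    field
      Good      : List (Fin n) → Set
      potential : List (Fin n) → Bool
      potential-[] : potential [] ≡ false
      good-or-no-even-arrangements : ∀ k T → evenArrangements k T ≡ + 0 ⊎ Good T
      potential-step : ∀ {S y ys} → S ↭ y ∷ ys → odd (edgesIn G S) ≡ false → odd (edgesIn G ys) ≡ false →
                       Good ys → potential S ≡ odd (count (D y) ys) xor potential ys

  reorient : ∀ {R D} → IsOrientation G R → IsOrientation G D → SignPotential R → SignPotential D
  reorient {R} {D} R-orientation D-orientation P = record
    { Good                         = Good
    ; potential                    = λ S → potential S xor odd (pairCount disagree S)
    ; potential-[]                 = cong (_xor false) potential-[]
    ; good-or-no-even-arrangements = good-or-no-even-arrangements
    ; potential-step               = step
    }
    where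
    open SignPotential P
    disagree : Fin n → Fin n → Bool
    disagree x y = D x y xor R x y
    disagree-sym : ∀ x y → disagree x y ≡ disagree y x
    disagree-sym x y = xor-transpose (D x y) (D y x) (R x y) (R y x)
      (trans (orientation-xor G D-orientation x y) (sym (orientation-xor G R-orientation x y)))
    step : ∀ {S y ys} → S ↭ y ∷ ys → odd (edgesIn G S) ≡ false → odd (edgesIn G ys) ≡ false → Good ys →
           potential S xor odd (pairCount disagree S) ≡ odd (count (D y) ys) xor (potential ys xor odd (pairCount disagree ys))
    step {S} {y} {ys} S↭ even-S even-ys good = begin
      potential S xor odd (pairCount disagree S)
        ≡⟨ cong₂ _xor_ (potential-step S↭ even-S even-ys good) (cong odd (pairCount-↭ disagree disagree-sym S↭)) ⟩
      (r xor potential ys) xor odd (count (disagree y) ys + pairCount disagree ys)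
        ≡⟨ cong ((r xor potential ys) xor_) (trans (odd-+ (count (disagree y) ys) (pairCount disagree ys))
                                                   (cong (_xor odd (pairCount disagree ys)) (odd-count-xor (D y) (R y) ys))) ⟩
      (r xor potential ys) xor ((d xor r) xor odd (pairCount disagree ys))
        ≡⟨ xor-interchange r (potential ys) (d xor r) (odd (pairCount disagree ys)) ⟩
      (r xor (d xor r)) xor (potential ys xor odd (pairCount disagree ys))
        ≡⟨ cong (_xor (potential ys xor odd (pairCount disagree ys))) (trans (cong (r xor_) (B.xor-comm d r))
             (trans (sym (B.xor-assoc r r d)) (cong (_xor d) (B.xor-same r)))) ⟩
      d xor (potential ys xor odd (pairCount disagree ys)) ∎
      where
      open ≡-Reasoning
      r d : Bool
      r = odd (count (R y) ys)
      d = odd (count (D y) ys)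

  module Signed (D : Digraph n) (D-orientation : IsOrientation G D) where

    descentSign : List (Fin n) → ℤ
    descentSign ρ = signPow (pairCount D ρ)

    signedArrangements : ℕ → List (Fin n) → ℤ
    signedArrangements k S = ∑ (permutations k S) descentSign

    signedArrangements-suc : ∀ k S → signedArrangements (suc k) S
      ≡ ∑[ p ← select S ] (signPow (count (D (proj₁ p)) (proj₂ p)) * signedArrangements k (proj₂ p))
    signedArrangements-suc k S =
      trans (∑-permutations-suc k S descentSign)
            (∑-cong (select S) (λ { {y , ys} _ → trans (∑-cong (permutations k ys) (λ {ρ} → factor y ys {ρ}))
                                                       (∑-*ˡ (permutations k ys) (signPow (count (D y) ys)) descentSign) }))
      where
      factor : ∀ y ys {ρ} → ρ ∈ permutations k ys →
               signPow (pairCount D (y ∷ ρ)) ≡ signPow (count (D y) ys) * signPow (pairCount D ρ)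
      factor y ys {ρ} ρ∈ = trans (signPow-+ (count (D y) ρ) _)
        (cong (λ c → signPow c * signPow (pairCount D ρ)) (count-↭ (D y) (proj₁ (∈-permutations⁻ k ys ρ∈))))

    -- reversing an ordering of a set with an odd number of edges changes the sign
    signedArrangements-odd : ∀ k S → Unique S → odd (edgesIn G S) ≡ true → signedArrangements k S ≡ + 0
    signedArrangements-odd k S S! odd-e = self-negative (begin
      signedArrangements k S
        ≡⟨ ∑-↭ descentSign (permutations-reverse k S!) ⟨
      ∑ (map reverse (permutations k S)) descentSign
        ≡⟨ ∑-map reverse (permutations k S) descentSign ⟩
      ∑[ ρ ← permutations k S ] descentSign (reverse ρ)
        ≡⟨ ∑-cong (permutations k S) (λ {ρ} ρ∈ →
             descentSign-reverse {ρ} (trans (cong odd (edgesIn-↭ G (proj₁ (∈-permutations⁻ k S ρ∈)))) odd-e)) ⟩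
      ∑[ ρ ← permutations k S ] (- descentSign ρ)
        ≡⟨ ∑-neg (permutations k S) descentSign ⟩
      - signedArrangements k S ∎)
      where
      open ≡-Reasoning
      self-negative : ∀ {x : ℤ} → x ≡ - x → x ≡ + 0
      self-negative {+ zero}          _  = refl
      self-negative {+ suc _}         ()
      self-negative { -[1+ _ ]}       ()
      descentSign-reverse : ∀ {ρ} → odd (edgesIn G ρ) ≡ true → descentSign (reverse ρ) ≡ - descentSign ρ
      descentSign-reverse {ρ} odd-ρ = trans (cong signPow (pairCount-reverse D ρ))
        (signPow-complement (pairCount D ρ) (pairCount (λ x y → D y x) ρ) (trans (cong odd both-directions) odd-ρ))
        where
        both-directions : pairCount D ρ + pairCount (λ x y → D y x) ρ ≡ edgesIn G ρ
        both-directions = trans (pairCount-+ D (λ x y → D y x) (adj G) (arcs-both-ways G D-orientation) ρ)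
                                (sym (edgesIn≡pairCount G ρ))

    signedArrangements≡±evenArrangements : (P : SignPotential D) → let open SignPotential P in
      ∀ k S → Unique S → signedArrangements k S ≡ sign (potential S) * evenArrangements k S
    signedArrangements≡±evenArrangements P zero [] _ rewrite SignPotential.potential-[] P = refl
    signedArrangements≡±evenArrangements P zero (x ∷ S) _ = sym (ℤ.*-zeroʳ (sign (SignPotential.potential P (x ∷ S))))
    signedArrangements≡±evenArrangements P (suc k) S S! with odd (edgesIn G S) in odd-S
    ... | true = trans (signedArrangements-odd (suc k) S S! odd-S)
                       (sym (trans (cong (sign (potential S) *_) (evenArrangements-odd (suc k) S odd-S))
                                   (ℤ.*-zeroʳ (sign (potential S)))))
      where open SignPotential P
    ... | false = begin
      signedArrangements (suc k) S
        ≡⟨ signedArrangements-suc k S ⟩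
      ∑[ p ← select S ] (signPow (count (D (proj₁ p)) (proj₂ p)) * signedArrangements k (proj₂ p))
        ≡⟨ ∑-cong (select S) (λ { {y , ys} p∈ → step p∈ }) ⟩
      ∑[ p ← select S ] (sign (potential S) * evenArrangements k (proj₂ p))
        ≡⟨ ∑-*ˡ (select S) (sign (potential S)) (λ p → evenArrangements k (proj₂ p)) ⟩
      sign (potential S) * ∑[ p ← select S ] evenArrangements k (proj₂ p)
        ≡⟨ cong (sign (potential S) *_) (evenArrangements-even k S odd-S) ⟨
      sign (potential S) * evenArrangements (suc k) S ∎
      where
      open ≡-Reasoning
      open SignPotential P
      vanishing : ∀ {y ys} → evenArrangements k ys ≡ + 0 →
        signPow (count (D y) ys) * (sign (potential ys) * evenArrangements k ys) ≡ sign (potential S) * evenArrangements k ys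
      vanishing {y} {ys} none rewrite none | ℤ.*-zeroʳ (sign (potential ys)) | ℤ.*-zeroʳ (signPow (count (D y) ys)) =
        sym (ℤ.*-zeroʳ (sign (potential S)))
      step : ∀ {y ys} → (y , ys) ∈ select S →
             signPow (count (D y) ys) * signedArrangements k ys ≡ sign (potential S) * evenArrangements k ys
      step {y} {ys} p∈ rewrite signedArrangements≡±evenArrangements P k ys (select-unique S! p∈)
        with good-or-no-even-arrangements k ys | odd (edgesIn G ys) in odd-ys
      ... | inj₁ none | _     = vanishing none
      ... | inj₂ _    | true  = vanishing (evenArrangements-odd k ys odd-ys)
      ... | inj₂ good | false =
        trans (signPow-*-sign (count (D y) ys) (potential ys) (evenArrangements k ys))
              (cong (λ b → sign b * evenArrangements k ys) (sym (potential-step (select-↭ S p∈) odd-S odd-ys good)))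

flip-orientation : ∀ {n} {G : Graph n} {D} → IsOrientation G D → IsOrientation G (λ x y → D y x)
flip-orientation {G = G} {D} (asym , covers) = (λ x y → asym y x) , (λ x y → trans (covers x y) (B.∨-comm (D x y) (D y x)))

∣sign*+∣ : ∀ b m → ∣ sign b * + m ∣ ≡ m
∣sign*+∣ b m = trans (ℤ.abs-* (sign b) (+ m)) (trans (cong (λ k → k Data.Nat.* m) (∣sign∣ b)) (ℕ.*-identityˡ m))
  where
  ∣sign∣ : ∀ b → ∣ sign b ∣ ≡ 1
  ∣sign∣ true  = refl
  ∣sign∣ false = refl

module _ {n : ℕ} (G : Graph n) where
  open Arrangements G

  signPotential⇒∣eulerian∣≡η : ∀ {R} → IsOrientation G R → SignPotential R →
                           ∀ D → IsOrientation G D → ∣ eulerianAtMinusOne D ∣ ≡ η G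
  signPotential⇒∣eulerian∣≡η R-orientation P D D-orientation = begin
    ∣ eulerianAtMinusOne D ∣
      ≡⟨ cong ∣_∣ (eulerianAtMinusOne≡∑ D) ⟩
    ∣ signedArrangements n (allFin n) ∣
      ≡⟨ cong ∣_∣ (signedArrangements≡±evenArrangements P⁻¹ n (allFin n) (Unique.allFin⁺ n)) ⟩
    ∣ sign β * evenArrangements n (allFin n) ∣
      ≡⟨ cong (λ m → ∣ sign β * m ∣) (count≡∑ (evenSuffixes G) (permutations n (allFin n))) ⟨
    ∣ sign β * + count (evenSuffixes G) (permutations n (allFin n)) ∣
      ≡⟨ ∣sign*+∣ β _ ⟩
    count (evenSuffixes G) (permutations n (allFin n))
      ≡⟨ η≡count G ⟨
    η G ∎
    where
    open ≡-Reasoning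
    D⁻¹-orientation : IsOrientation G (λ x y → D y x)
    D⁻¹-orientation = flip-orientation {G = G} {D} D-orientation
    P⁻¹ : SignPotential (λ x y → D y x)
    P⁻¹ = reorient R-orientation D⁻¹-orientation P
    β : Bool
    β = SignPotential.potential P⁻¹ (allFin n)
    open Signed (λ x y → D y x) D⁻¹-orientation

-- Bipartite graphs

module Bipartite {n : ℕ} (G : Graph n) (colour : Fin n → Bool)
                 (proper : ∀ u v → adj G u v ≡ true → colour u ≢ colour v) where
  open Arrangements G

  fromTrue : Digraph n
  fromTrue u v = adj G u v ∧ colour u

  fromTrue-orientation : IsOrientation G fromTrue
  fromTrue-orientation = asym , covers
    where
    other-colour : ∀ u v → adj G u v ≡ true → colour v ≡ not (colour u)
    other-colour u v uv = B.¬-not (proper u v uv ∘ sym)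
    asym : ∀ u v → fromTrue u v ≡ true → fromTrue v u ≡ false
    asym u v uv→ with adj G u v in uv | colour u in cu
    ... | true | true rewrite Graph.sym G v u | uv | other-colour u v uv | cu = refl
    covers : ∀ u v → adj G u v ≡ (fromTrue u v ∨ fromTrue v u)
    covers u v rewrite Graph.sym G v u with adj G u v in uv
    ... | false = refl
    ... | true rewrite other-colour u v uv with colour u
    ...   | true  = refl
    ...   | false = refl

  potential : SignPotential fromTrue
  potential = record
    { Good                         = λ _ → ⊤
    ; potential                    = λ _ → false
    ; potential-[]                 = refl
    ; good-or-no-even-arrangements = λ _ _ → inj₂ tt
    ; potential-step               = λ {S} {y} {ys} S↭ even-S even-ys _ →
        sym (trans (B.xor-identityʳ _) (out-degree-even S↭ even-S even-ys))
    }
    where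
    out-degree-even : ∀ {S y ys} → S ↭ y ∷ ys → odd (edgesIn G S) ≡ false → odd (edgesIn G ys) ≡ false →
                      odd (count (fromTrue y) ys) ≡ false
    out-degree-even {y = y} {ys} S↭ even-S even-ys with colour y
    ... | true  = trans (cong odd (count-cong ys (λ {w} _ → B.∧-identityʳ (adj G y w)))) (degree-even G S↭ even-S even-ys)
    ... | false = cong odd (trans (count-cong ys (λ {w} _ → B.∧-zeroʳ (adj G y w))) (count-false ys))

-- Complete multipartite graphs

⨁ : ∀ {r} → (Fin r → Bool) → Bool
⨁ h = foldr _xor_ false (List.tabulate h)

⨁-cong : ∀ {r} {h h′ : Fin r → Bool} → (∀ b → h b ≡ h′ b) → ⨁ h ≡ ⨁ h′
⨁-cong h≗h′ = cong (foldr _xor_ false) (L.tabulate-cong h≗h′)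

⨁-false : ∀ {r} → ⨁ {r} (λ _ → false) ≡ false
⨁-false {zero}  = refl
⨁-false {suc r} = ⨁-false {r}

⨁-xor : ∀ {r} (h h′ : Fin r → Bool) → ⨁ (λ b → h b xor h′ b) ≡ ⨁ h xor ⨁ h′
⨁-xor {zero}  h h′ = refl
⨁-xor {suc r} h h′ = trans (cong ((h Fin.zero xor h′ Fin.zero) xor_) (⨁-xor (h ∘ Fin.suc) (h′ ∘ Fin.suc)))
                           (xor-interchange (h Fin.zero) (h′ Fin.zero) (⨁ (h ∘ Fin.suc)) (⨁ (h′ ∘ Fin.suc)))

⨁-single : ∀ {r} (q : Fin r → Bool) a → ⨁ (λ b → q b ∧ does (a ≟ b)) ≡ q a
⨁-single {suc r} q Fin.zero = begin
  (q Fin.zero ∧ true) xor ⨁ (λ b → q (Fin.suc b) ∧ false)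
    ≡⟨ cong₂ _xor_ (B.∧-identityʳ (q Fin.zero)) (⨁-cong {h = λ b → q (Fin.suc b) ∧ false} (B.∧-zeroʳ ∘ q ∘ Fin.suc)) ⟩
  q Fin.zero xor ⨁ {r} (λ _ → false)                       ≡⟨ cong (q Fin.zero xor_) (⨁-false {r}) ⟩
  q Fin.zero xor false                                     ≡⟨ B.xor-identityʳ _ ⟩
  q Fin.zero                                               ∎
  where open ≡-Reasoning
⨁-single {suc r} q (Fin.suc a) =
  trans (cong (_xor ⨁ (λ b → q (Fin.suc b) ∧ does (a ≟ b))) (B.∧-zeroʳ (q Fin.zero))) (⨁-single (q ∘ Fin.suc) a)

module PartParity {n r : ℕ} (part : Fin n → Fin r) where

  oddIn : List (Fin n) → Fin r → Bool
  oddIn T b = odd (count (λ w → does (part w ≟ b)) T)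

  oddIn-↭ : ∀ {S y ys} → S ↭ y ∷ ys → ∀ b → oddIn S b ≡ does (part y ≟ b) xor oddIn ys b
  oddIn-↭ {y = y} {ys} S↭ b = trans (cong odd (count-↭ _ S↭)) (odd-count-∷ (λ w → does (part w ≟ b)) y ys)

  odd-count∘part : ∀ (q : Fin r → Bool) T → odd (count (q ∘ part) T) ≡ ⨁ (λ b → q b ∧ oddIn T b)
  odd-count∘part q []      = sym (trans (⨁-cong (λ b → B.∧-zeroʳ (q b))) (⨁-false {r}))
  odd-count∘part q (w ∷ T) = begin
    odd (count (q ∘ part) (w ∷ T))
      ≡⟨ odd-count-∷ (q ∘ part) w T ⟩
    q (part w) xor odd (count (q ∘ part) T)
      ≡⟨ cong₂ _xor_ (⨁-single q (part w)) (sym (odd-count∘part q T)) ⟨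
    ⨁ (λ b → q b ∧ does (part w ≟ b)) xor ⨁ (λ b → q b ∧ oddIn T b)
      ≡⟨ ⨁-xor (λ b → q b ∧ does (part w ≟ b)) (λ b → q b ∧ oddIn T b) ⟨
    ⨁ (λ b → (q b ∧ does (part w ≟ b)) xor (q b ∧ oddIn T b))
      ≡⟨ ⨁-cong (λ b → trans (cong (q b ∧_) (odd-count-∷ (λ v → does (part v ≟ b)) w T)) (B.∧-distribˡ-xor (q b) _ _)) ⟨
    ⨁ (λ b → q b ∧ oddIn (w ∷ T) b) ∎
    where open ≡-Reasoning

module CompleteMultipartite {n r : ℕ} (G : Graph n) (part : Fin n → Fin r)
                            (adj⇔ : ∀ u v → (adj G u v ≡ true) ⇔ (part u ≢ part v)) where
  open Arrangements G
  open PartParity part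

  adj≡different-parts : ∀ u v → adj G u v ≡ not (does (part u ≟ part v))
  adj≡different-parts u v with adj G u v in uv | part u ≟ part v
  ... | true  | yes same = contradiction same (Equivalence.to (adj⇔ u v) uv)
  ... | true  | no  _    = refl
  ... | false | yes _    = refl
  ... | false | no  diff with () ← trans (sym uv) (Equivalence.from (adj⇔ u v) diff)

  upward : Digraph n
  upward u v = does (part u Fin.<? part v)

  upward-orientation : IsOrientation G upward
  upward-orientation = asym , covers
    where
    asym : ∀ u v → upward u v ≡ true → upward v u ≡ false
    asym u v uv = dec-false (part v Fin.<? part u) (Fin.<-asym (does-true (part u Fin.<? part v) uv))
    covers : ∀ u v → adj G u v ≡ (upward u v ∨ upward v u)
    covers u v rewrite adj≡different-parts u v with Fin.<-cmp (part u) (part v)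
    ... | tri< lt ne _  rewrite dec-false (part u ≟ part v) ne | dec-true (part u Fin.<? part v) lt = refl
    ... | tri≈ nlt eq _ rewrite dec-true (part u ≟ part v) eq | dec-false (part u Fin.<? part v) nlt
                              | dec-false (part v Fin.<? part u) (Fin.<-irrefl (sym eq)) = refl
    ... | tri> _ ne gt  rewrite dec-false (part u ≟ part v) ne | dec-true (part v Fin.<? part u) gt =
      sym (B.∨-zeroʳ (upward u v))

  Good Bad : List (Fin n) → Set
  Good T = ∀ a b → oddIn T a ≡ true → oddIn T b ≡ true → a ≡ b
  Bad  T = ∃₂ λ a b → a ≢ b × oddIn T a ≡ true × oddIn T b ≡ true

  good-or-bad : ∀ T → Good T ⊎ Bad T
  good-or-bad T with Fin.any? (λ a → Fin.any? (λ b → ¬? (a ≟ b) ×-dec (oddIn T a B.≟ true) ×-dec (oddIn T b B.≟ true)))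
  ... | yes (a , b , a≢b , odd-a , odd-b) = inj₂ (a , b , a≢b , odd-a , odd-b)
  ... | no  ¬bad = inj₁ λ a b odd-a odd-b → decidable-stable (a ≟ b) (λ a≢b → ¬bad (a , b , a≢b , odd-a , odd-b))

  lone-odd-part : ∀ {T a} → Good T → oddIn T a ≡ true → ∀ b → oddIn T b ≡ does (a ≟ b)
  lone-odd-part {T} {a} good odd-a b with oddIn T b in odd-b | a ≟ b
  ... | true  | yes _    = refl
  ... | true  | no  a≢b  = contradiction (good a b odd-a odd-b) a≢b
  ... | false | yes refl with () ← trans (sym odd-a) odd-b
  ... | false | no  _    = refl

  degree-parity : ∀ y ys → odd (count (adj G y) ys) ≡ ⨁ (λ b → not (does (part y ≟ b)) ∧ oddIn ys b)
  degree-parity y ys = trans (cong odd (count-cong ys (λ {w} _ → adj≡different-parts y w)))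
                             (odd-count∘part (λ b → not (does (part y ≟ b))) ys)

  in-lone-odd-part : ∀ {S y ys a} → S ↭ y ∷ ys → odd (edgesIn G S) ≡ false → odd (edgesIn G ys) ≡ false →
                     Good ys → oddIn ys a ≡ true → part y ≡ a
  in-lone-odd-part {S} {y} {ys} {a} S↭ even-S even-ys good odd-a = does-true (part y ≟ a) (begin
    does (part y ≟ a)                                  ≡⟨ B.not-involutive _ ⟨
    not (not (does (part y ≟ a)))                      ≡⟨ cong not (⨁-single (λ b → not (does (part y ≟ b))) a) ⟨
    not (⨁ (λ b → not (does (part y ≟ b)) ∧ does (a ≟ b)))
      ≡⟨ cong not (⨁-cong (λ b → cong (not (does (part y ≟ b)) ∧_) (lone-odd-part {ys} {a} good odd-a b))) ⟨
    not (⨁ (λ b → not (does (part y ≟ b)) ∧ oddIn ys b))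
      ≡⟨ cong not (trans (sym (degree-parity y ys)) (degree-even G S↭ even-S even-ys)) ⟩
    true                                               ∎)
    where open ≡-Reasoning

  out-degree-even : ∀ {S y ys} → S ↭ y ∷ ys → odd (edgesIn G S) ≡ false → odd (edgesIn G ys) ≡ false →
                    Good ys → odd (count (upward y) ys) ≡ false
  out-degree-even {S} {y} {ys} S↭ even-S even-ys good
    rewrite odd-count∘part (λ b → does (part y Fin.<? b)) ys
    with Fin.any? (λ a → oddIn ys a B.≟ true)
  ... | yes (a , odd-a) = begin
    ⨁ (λ b → does (part y Fin.<? b) ∧ oddIn ys b)
      ≡⟨ ⨁-cong (λ b → cong (does (part y Fin.<? b) ∧_) (lone-odd-part {ys} good odd-a b)) ⟩
    ⨁ (λ b → does (part y Fin.<? b) ∧ does (a ≟ b))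
      ≡⟨ ⨁-single (λ b → does (part y Fin.<? b)) a ⟩
    does (part y Fin.<? a)
      ≡⟨ dec-false (part y Fin.<? a) (Fin.<-irrefl (in-lone-odd-part S↭ even-S even-ys good odd-a)) ⟩
    false ∎
    where open ≡-Reasoning
  ... | no none = trans (⨁-cong (λ b → trans (cong (does (part y Fin.<? b) ∧_) (even-part b)) (B.∧-zeroʳ _))) (⨁-false {r})
    where
    even-part : ∀ b → oddIn ys b ≡ false
    even-part b = B.¬-not (λ odd-b → none (b , odd-b))

  odd-after-removal : ∀ {S y ys c} → S ↭ y ∷ ys → part y ≢ c → oddIn S c ≡ true → oddIn ys c ≡ true
  odd-after-removal {S} {y} {ys} {c} S↭ y∉c odd-c =
    trans (sym (cong (_xor oddIn ys c) (dec-false (part y ≟ c) y∉c))) (trans (sym (oddIn-↭ S↭ c)) odd-c)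

  another-odd-part : ∀ {S y ys c} → S ↭ y ∷ ys → odd (edgesIn G S) ≡ false → odd (edgesIn G ys) ≡ false →
                     oddIn ys c ≡ true → part y ≢ c → Bad ys
  another-odd-part {S} {y} {ys} {c} S↭ even-S even-ys odd-c y∉c
    with Fin.any? (λ d → ¬? (d ≟ c) ×-dec (oddIn ys d B.≟ true))
  ... | yes (d , d≢c , odd-d) = d , c , d≢c , odd-d , odd-c
  ... | no  none              = contradiction (in-lone-odd-part S↭ even-S even-ys good odd-c) y∉c
    where
    only-c : ∀ d → oddIn ys d ≡ true → d ≡ c
    only-c d odd-d = decidable-stable (d ≟ c) (λ d≢c → none (d , d≢c , odd-d))
    good : Good ys
    good a b odd-a odd-b = trans (only-c a odd-a) (sym (only-c b odd-b))

  bad-step : ∀ {S y ys} → S ↭ y ∷ ys → odd (edgesIn G S) ≡ false → odd (edgesIn G ys) ≡ false → Bad S → Bad ys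
  bad-step {S} {y} {ys} S↭ even-S even-ys (a , b , a≢b , odd-a , odd-b) with part y ≟ a | part y ≟ b
  ... | no y∉a  | no y∉b  = a , b , a≢b , odd-after-removal S↭ y∉a odd-a , odd-after-removal S↭ y∉b odd-b
  ... | yes y∈a | _       = another-odd-part S↭ even-S even-ys (odd-after-removal S↭ y∉b odd-b) y∉b
    where
    y∉b : part y ≢ b
    y∉b y∈b = a≢b (trans (sym y∈a) y∈b)
  ... | no y∉a  | yes _   = another-odd-part S↭ even-S even-ys (odd-after-removal S↭ y∉a odd-a) y∉a

  bad⇒no-even-arrangements : ∀ k T → Bad T → evenArrangements k T ≡ + 0
  bad⇒no-even-arrangements zero    []      (_ , _ , _ , () , _)
  bad⇒no-even-arrangements zero    (_ ∷ _) _   = refl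
  bad⇒no-even-arrangements (suc k) T       bad with odd (edgesIn G T) in odd-T
  ... | true  = evenArrangements-odd (suc k) T odd-T
  ... | false = trans (evenArrangements-even k T odd-T) (trans (∑-cong (select T) none-after) (∑-zero (select T)))
    where
    none-after : ∀ {p} → p ∈ select T → evenArrangements k (proj₂ p) ≡ + 0
    none-after {y , ys} p∈ with odd (edgesIn G ys) in odd-ys
    ... | true  = evenArrangements-odd k ys odd-ys
    ... | false = bad⇒no-even-arrangements k ys (bad-step (select-↭ T p∈) odd-T odd-ys bad)

  potential : SignPotential upward
  potential = record
    { Good                         = Good
    ; potential                    = λ _ → false
    ; potential-[]                 = refl
    ; good-or-no-even-arrangements = λ k T → Data.Sum.map₁ (bad⇒no-even-arrangements k T) (Data.Sum.swap (good-or-bad T))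
    ; potential-step               = λ S↭ even-S even-ys good →
        sym (trans (B.xor-identityʳ _) (out-degree-even S↭ even-S even-ys good))
    }

-- Blowups of cycles

module _ {k : ℕ} where

  next : Fin (suc k) → Fin (suc k)
  next b = suc (toℕ b) mod suc k

  toℕ-next : ∀ b → toℕ (next b) ≡ suc (toℕ b) % suc k
  toℕ-next b = Fin.toℕ-fromℕ< _

  next-cases : ∀ b → (toℕ b ≡ k × toℕ (next b) ≡ 0) ⊎ (toℕ b ≢ k × toℕ (next b) ≡ suc (toℕ b))
  next-cases b with toℕ b ℕ.≟ k
  ... | yes last = inj₁ (last , trans (toℕ-next b) (trans (cong (λ i → suc i % suc k) last) (DivMod.n%n≡0 (suc k))))
  ... | no  ¬last = inj₂ (¬last , trans (toℕ-next b) (DivMod.m<n⇒m%n≡m (s≤s (ℕ.≤∧≢⇒< (Fin.toℕ≤pred[n] b) ¬last))))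

  next-injective : Injective _≡_ _≡_ next
  next-injective {a} {b} e with next-cases a | next-cases b
  ... | inj₁ (a-last , _)  | inj₁ (b-last , _)  = Fin.toℕ-injective (trans a-last (sym b-last))
  ... | inj₁ (_ , a-next)  | inj₂ (_ , b-next)  with () ← trans (sym a-next) (trans (cong toℕ e) b-next)
  ... | inj₂ (_ , a-next)  | inj₁ (_ , b-next)  with () ← trans (sym b-next) (trans (cong toℕ (sym e)) a-next)
  ... | inj₂ (_ , a-next)  | inj₂ (_ , b-next)  = Fin.toℕ-injective (ℕ.suc-injective (trans (sym a-next) (trans (cong toℕ e) b-next)))

next≢id : ∀ {k} (b : Fin (2 + k)) → next b ≢ b
next≢id b e with next-cases b
... | inj₁ (b-last , b-next) with () ← trans (sym b-last) (trans (cong toℕ (sym e)) b-next)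
... | inj₂ (_ , b-next)      = ℕ.1+n≢n (trans (sym b-next) (cong toℕ e))

next²≢id : ∀ {k} (b : Fin (3 + k)) → next (next b) ≢ b
next²≢id b e with next-cases b | next-cases (next b)
... | inj₁ (_ , b-next)      | inj₁ (b′-last , _)       with () ← trans (sym b-next) b′-last
... | inj₁ (b-last , b-next) | inj₂ (_ , b′-next)       with () ←
  trans (sym b-last) (trans (cong toℕ (sym e)) (trans b′-next (cong suc b-next)))
... | inj₂ (_ , b-next)      | inj₁ (b′-last , b′-next) with () ←
  trans (sym b′-last) (trans b-next (cong suc (trans (cong toℕ (sym e)) b′-next)))
... | inj₂ (_ , b-next)      | inj₂ (_ , b′-next)       =
  ℕ.m≢1+n+m (toℕ b) {1} (trans (cong toℕ (sym e)) (trans b′-next (cong suc b-next)))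

CyclicNeighbours : ∀ k → Fin (suc k) → Fin (suc k) → Set
CyclicNeighbours k a b = (toℕ b ≡ suc (toℕ a) % suc k) ⊎ (toℕ a ≡ suc (toℕ b) % suc k)

blowup-C₁⇒complete : ∀ {n} (G : Graph n) (part : Fin n → Fin 1) →
                     (∀ u v → u ≢ v → (adj G u v ≡ true) ⇔ CyclicNeighbours 0 (part u) (part v)) →
                     IsCompleteMultipartite G
blowup-C₁⇒complete {n} G part adj⇔ = n , (λ u → u) , λ u v → mk⇔ (non-loop u v) (adjacent u v)
  where
  non-loop : ∀ u v → adj G u v ≡ true → u ≢ v
  non-loop u v uv refl with () ← trans (sym (Graph.irrefl G u)) uv
  adjacent : ∀ u v → u ≢ v → adj G u v ≡ true
  adjacent u v u≢v with part u | part v | Equivalence.from (adj⇔ u v u≢v)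
  ... | Fin.zero | Fin.zero | from = from (inj₁ refl)

blowup-C₂⇒bipartite : ∀ {n} (G : Graph n) (part : Fin n → Fin 2) →
                      (∀ u v → u ≢ v → (adj G u v ≡ true) ⇔ CyclicNeighbours 1 (part u) (part v)) →
                      IsBipartite G
blowup-C₂⇒bipartite G part adj⇔ = (λ u → does (part u ≟ Fin.zero)) , proper
  where
  different : ∀ a b → CyclicNeighbours 1 a b → does (a ≟ Fin.zero) ≢ does (b ≟ Fin.zero)
  different Fin.zero            Fin.zero            (inj₁ ())
  different Fin.zero            Fin.zero            (inj₂ ())
  different Fin.zero            (Fin.suc Fin.zero)  _ ()
  different (Fin.suc Fin.zero)  Fin.zero            _ ()
  different (Fin.suc Fin.zero)  (Fin.suc Fin.zero)  (inj₁ ())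
  different (Fin.suc Fin.zero)  (Fin.suc Fin.zero)  (inj₂ ())
  proper : ∀ u v → adj G u v ≡ true → does (part u ≟ Fin.zero) ≢ does (part v ≟ Fin.zero)
  proper u v uv with u ≟ v
  ... | yes refl with () ← trans (sym (Graph.irrefl G u)) uv
  ... | no  u≢v  = different (part u) (part v) (Equivalence.to (adj⇔ u v u≢v) uv)

module CycleBlowup {n m : ℕ} (G : Graph n) (part : Fin n → Fin (3 + m))
                   (adj⇔ : ∀ u v → u ≢ v → (adj G u v ≡ true) ⇔ CyclicNeighbours (2 + m) (part u) (part v)) where
  open Arrangements G
  open PartParity part

  forward : Digraph n
  forward u v = does (part v ≟ next (part u))

  forward-orientation : IsOrientation G forward
  forward-orientation = asym , covers
    where
    successor : ∀ {u v} → forward u v ≡ true → toℕ (part v) ≡ suc (toℕ (part u)) % (3 + m)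
    successor {u} {v} uv = trans (cong toℕ (does-true (part v ≟ next (part u)) uv)) (toℕ-next (part u))
    successor⁻¹ : ∀ {u v} → toℕ (part v) ≡ suc (toℕ (part u)) % (3 + m) → forward u v ≡ true
    successor⁻¹ {u} {v} e = dec-true (part v ≟ next (part u)) (Fin.toℕ-injective (trans e (sym (toℕ-next (part u)))))
    asym : ∀ u v → forward u v ≡ true → forward v u ≡ false
    asym u v uv = dec-false (part u ≟ next (part v)) λ u→v→u →
      next²≢id (part u) (sym (trans u→v→u (cong next (does-true (part v ≟ next (part u)) uv))))
    covers : ∀ u v → adj G u v ≡ (forward u v ∨ forward v u)
    covers u v with u ≟ v
    ... | yes refl rewrite Graph.irrefl G u | dec-false (part u ≟ next (part u)) (next≢id (part u) ∘ sym) = refl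
    ... | no  u≢v with adj G u v in uv | forward u v in uv→ | forward v u in vu→
    ...   | true  | true  | _     = refl
    ...   | true  | false | true  = refl
    ...   | true  | false | false with Equivalence.to (adj⇔ u v u≢v) uv
    ...     | inj₁ e with () ← trans (sym uv→) (successor⁻¹ e)
    ...     | inj₂ e with () ← trans (sym vu→) (successor⁻¹ e)
    covers u v | no u≢v | false | true  | _    with () ← trans (sym uv) (Equivalence.from (adj⇔ u v u≢v) (inj₁ (successor uv→)))
    covers u v | no u≢v | false | false | true with () ← trans (sym uv) (Equivalence.from (adj⇔ u v u≢v) (inj₂ (successor vu→)))
    covers u v | no u≢v | false | false | false = refl

  oddPairs : List (Fin n) → ℕ
  oddPairs T = count (λ b → oddIn T b ∧ oddIn T (next b)) (allFin (3 + m))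

  module Step {S y ys} (S↭ : S ↭ y ∷ ys) (even-S : odd (edgesIn G S) ≡ false) (even-ys : odd (edgesIn G ys) ≡ false) where

    p q : Fin (3 + m)
    p = part y
    q = proj₁ (injective⇒surjective next-injective p)

    next-q : next q ≡ p
    next-q = proj₂ (injective⇒surjective next-injective p)

    -- y has an even number of neighbours in ys, split between parts q and next p
    oddIn-prev≡oddIn-next : oddIn ys q ≡ oddIn ys (next p)
    oddIn-prev≡oddIn-next = sym (xor≡false⇒≡ (begin
      oddIn ys (next p) xor oddIn ys q
        ≡⟨ cong (oddIn ys (next p) xor_) (cong odd (count-cong ys (λ {w} _ → into-y w))) ⟨
      odd (count (forward y) ys) xor odd (count (λ w → forward w y) ys)
        ≡⟨ odd-+ (count (forward y) ys) _ ⟨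
      odd (count (forward y) ys + count (λ w → forward w y) ys)
        ≡⟨ cong odd (count-+ (forward y) (λ w → forward w y) (adj G y) (arcs-both-ways G forward-orientation y) ys) ⟩
      odd (count (adj G y) ys)
        ≡⟨ degree-even G S↭ even-S even-ys ⟩
      false ∎))
      where
      open ≡-Reasoning
      into-y : ∀ w → forward w y ≡ does (part w ≟ q)
      into-y w with part w ≟ q
      ... | yes w∈q  = dec-true (p ≟ next (part w)) (sym (trans (cong next w∈q) next-q))
      ... | no  w∉q  = dec-false (p ≟ next (part w)) (λ e → w∉q (next-injective (trans (sym e) (sym next-q))))

    a x : Bool
    a = oddIn ys (next p)
    x = oddIn ys p

    q≢p : q ≢ p
    q≢p q≡p = next≢id p (trans (cong next (sym q≡p)) next-q)

    oddIn-S : ∀ {c} → p ≢ c → oddIn S c ≡ oddIn ys c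
    oddIn-S {c} p≢c = trans (oddIn-↭ S↭ c) (cong (_xor oddIn ys c) (dec-false (p ≟ c) p≢c))

    oddIn-S-p : oddIn S p ≡ not x
    oddIn-S-p = trans (oddIn-↭ S↭ p) (cong (_xor x) (dec-true (p ≟ p) refl))

    -- only the pairs (q, p) and (p, next p) change when y is removed
    oddPairs-step : oddPairs S + (bit (a ∧ x) + bit (a ∧ x)) ≡ oddPairs ys + (bit (a ∧ not x) + bit (a ∧ not x))
    oddPairs-step = begin
      oddPairs S + (bit (a ∧ x) + bit (a ∧ x))
        ≡⟨ cong (λ t → oddPairs S + t) (cong₂ _+_ (cong bit g-q) (cong bit g-p)) ⟨
      oddPairs S + (bit (g q) + bit (g p))
        ≡⟨ count-agree-off-two f g (Unique.allFin⁺ (3 + m)) (∈-allFin q) (∈-allFin p) q≢p agree ⟩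
      oddPairs ys + (bit (f q) + bit (f p))
        ≡⟨ cong (λ t → oddPairs ys + t) (cong₂ _+_ (cong bit f-q) (cong bit f-p)) ⟩
      oddPairs ys + (bit (a ∧ not x) + bit (a ∧ not x)) ∎
      where
      open ≡-Reasoning
      f g : Fin (3 + m) → Bool
      f b = oddIn S b ∧ oddIn S (next b)
      g b = oddIn ys b ∧ oddIn ys (next b)
      agree : ∀ {b} → b ∈ allFin (3 + m) → b ≢ q → b ≢ p → f b ≡ g b
      agree {b} _ b≢q b≢p =
        cong₂ _∧_ (oddIn-S (b≢p ∘ sym)) (oddIn-S (λ p≡nb → b≢q (next-injective (trans (sym p≡nb) (sym next-q)))))
      g-q : g q ≡ a ∧ x
      g-q = cong₂ _∧_ oddIn-prev≡oddIn-next (cong (oddIn ys) next-q)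
      g-p : g p ≡ a ∧ x
      g-p = B.∧-comm x a
      f-q : f q ≡ a ∧ not x
      f-q = cong₂ _∧_ (trans (oddIn-S (q≢p ∘ sym)) oddIn-prev≡oddIn-next) (trans (cong (oddIn S) next-q) oddIn-S-p)
      f-p : f p ≡ a ∧ not x
      f-p = trans (cong₂ _∧_ oddIn-S-p (oddIn-S (next≢id p ∘ sym))) (B.∧-comm (not x) a)

    potential-step : odd ⌊ oddPairs S /2⌋ ≡ a xor odd ⌊ oddPairs ys /2⌋
    potential-step = begin
      bS                 ≡⟨ xor-cancelʳ bS (a ∧ x) ⟨
      (bS xor (a ∧ x)) xor (a ∧ x)        ≡⟨ cong (_xor (a ∧ x)) parities ⟩
      (bY xor (a ∧ not x)) xor (a ∧ x)    ≡⟨ B.xor-assoc bY (a ∧ not x) (a ∧ x) ⟩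
      bY xor ((a ∧ not x) xor (a ∧ x))    ≡⟨ cong (bY xor_) (trans (sym (B.∧-distribˡ-xor a (not x) x))
                                              (trans (cong (a ∧_) (B.xor-inverseˡ x)) (B.∧-identityʳ a))) ⟩
      bY xor a                            ≡⟨ B.xor-comm bY a ⟩
      a xor bY                            ∎
      where
      open ≡-Reasoning
      bS bY : Bool
      bS = odd ⌊ oddPairs S /2⌋
      bY = odd ⌊ oddPairs ys /2⌋
      xor-cancelʳ : ∀ b u → (b xor u) xor u ≡ b
      xor-cancelʳ b u = trans (B.xor-assoc b u u) (trans (cong (b xor_) (B.xor-same u)) (B.xor-identityʳ b))
      halves : ⌊ oddPairs S /2⌋ + bit (a ∧ x) ≡ ⌊ oddPairs ys /2⌋ + bit (a ∧ not x)
      halves = trans (sym (⌊+double/2⌋ (oddPairs S) _)) (trans (cong ⌊_/2⌋ oddPairs-step) (⌊+double/2⌋ (oddPairs ys) _))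
      parities : bS xor (a ∧ x) ≡ bY xor (a ∧ not x)
      parities = begin
        bS xor (a ∧ x)                             ≡⟨ cong (bS xor_) (odd-bit (a ∧ x)) ⟨
        bS xor odd (bit (a ∧ x))                   ≡⟨ odd-+ ⌊ oddPairs S /2⌋ (bit (a ∧ x)) ⟨
        odd (⌊ oddPairs S /2⌋ + bit (a ∧ x))       ≡⟨ cong odd halves ⟩
        odd (⌊ oddPairs ys /2⌋ + bit (a ∧ not x))  ≡⟨ odd-+ ⌊ oddPairs ys /2⌋ (bit (a ∧ not x)) ⟩
        bY xor odd (bit (a ∧ not x))               ≡⟨ cong (bY xor_) (odd-bit (a ∧ not x)) ⟩
        bY xor (a ∧ not x)                         ∎

  potential : SignPotential forward
  potential = record
    { Good                         = λ _ → ⊤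
    ; potential                    = λ T → odd ⌊ oddPairs T /2⌋
    ; potential-[]                 = cong (λ c → odd ⌊ c /2⌋) (count-false (allFin (3 + m)))
    ; good-or-no-even-arrangements = λ _ _ → inj₂ tt
    ; potential-step               = λ S↭ even-S even-ys _ → Step.potential-step S↭ even-S even-ys
    }

module _ {n : ℕ} (G : Graph n) (D : Digraph n) (D-orientation : IsOrientation G D) where

  bipartite⇒∣eulerian∣≡η : IsBipartite G → ∣ eulerianAtMinusOne D ∣ ≡ η G
  bipartite⇒∣eulerian∣≡η (colour , proper) = signPotential⇒∣eulerian∣≡η G fromTrue-orientation potential D D-orientation
    where open Bipartite G colour proper

  completeMultipartite⇒∣eulerian∣≡η : IsCompleteMultipartite G → ∣ eulerianAtMinusOne D ∣ ≡ η G
  completeMultipartite⇒∣eulerian∣≡η (_ , part , adj⇔) = signPotential⇒∣eulerian∣≡η G upward-orientation potential D D-orientation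
    where open CompleteMultipartite G part adj⇔

  cycleBlowup⇒∣eulerian∣≡η : IsCycleBlowup G → ∣ eulerianAtMinusOne D ∣ ≡ η G
  cycleBlowup⇒∣eulerian∣≡η (0           , part , adj⇔) = completeMultipartite⇒∣eulerian∣≡η (blowup-C₁⇒complete G part adj⇔)
  cycleBlowup⇒∣eulerian∣≡η (1           , part , adj⇔) = bipartite⇒∣eulerian∣≡η (blowup-C₂⇒bipartite G part adj⇔)
  cycleBlowup⇒∣eulerian∣≡η (suc (suc m) , part , adj⇔) = signPotential⇒∣eulerian∣≡η G forward-orientation potential D D-orientation
    where open CycleBlowup G part adj⇔

theorem1p4 : (n : ℕ) (G : Graph n) →
    (IsBipartite G ⊎ IsCompleteMultipartite G ⊎ IsCycleBlowup G) →
    (D : Digraph n) → IsOrientation G D →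
    ∣ eulerianAtMinusOne D ∣ ≡ η G
theorem1p4 n G (inj₁ bipartite)          D D-orientation = bipartite⇒∣eulerian∣≡η G D D-orientation bipartite
theorem1p4 n G (inj₂ (inj₁ multipartite)) D D-orientation = completeMultipartite⇒∣eulerian∣≡η G D D-orientation multipartite
theorem1p4 n G (inj₂ (inj₂ blowup))      D D-orientation = cycleBlowup⇒∣eulerian∣≡η G D D-orientation blowup
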